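{- For integers $n,d,h,k\ge 0$ with $(n,k,h,d)\neq(0,0,1,1)$, \[ p_n^{(\mathrm{pk},\mathrm{dp},\mathrm{des})}(k,h,d)+p_n^{(\mathrm{pk},\mathrm{dp},\mathrm{des})}(k,h-1,d-1)=\sum_{i,j}\binom{n}{2i+h}\, b_{2i+h}^{(\mathrm{pk},\mathrm{des})}(j,i)\, b_{n-2i-h}^{(\mathrm{pk},\mathrm{des})}(k-j,\,d-i-h), \] the sum over all integers $i,j$. Equivalently, as formal power series, \[ B^{(\mathrm{pk},\mathrm{des})}\Big(xzt,\,y,\,\frac{1}{z^2t}\Big)B^{(\mathrm{pk},\mathrm{des})}(x,y,t)=(1+zt)\,P^{(\mathrm{pk},\mathrm{dp},\mathrm{des})}(x,y,z,t)-zt. \]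
   Context: For $\pi=\pi_1\cdots\pi_n\in\mathcal S_n$, $\operatorname{des}(\pi)$ ($\operatorname{asc}(\pi)$) is the number of positions $1\le i\le n-1$ with $\pi_i>\pi_{i+1}$ ($\pi_i<\pi_{i+1}$); $\operatorname{pk}(\pi)$ is the number of positions $2\le i\le n-1$ with $\pi_{i-1}<\pi_i>\pi_{i+1}$. Let $h(\sigma)=\operatorname{asc}(\sigma)-\operatorname{des}(\sigma)$ and define the depth $\operatorname{dp}(\pi)=-\min\{h(\pi_1\cdots\pi_i):1\le i\le n\}$, with $\operatorname{dp}(\epsilon)=0$. $\pi$ is a ballot permutation if $h(\pi_1\cdots\pi_i)\ge0$ for all $i$; $\mathscr B_n$ is the set of ballot permutations of $[n]$, and $\mathscr B_0=\mathcal S_0=\{\epsilon\}$ (empty permutation, all statistics $0$). $p_n^{(\mathrm{pk},\mathrm{dp},\mathrm{des})}(k,h,d)$ is the number of $\pi\in\mathcal S_n$ with $\operatorname{pk}=k,\operatorname{dp}=h,\operatorname{des}=d$; $b_n^{(\mathrm{pk},\mathrm{des})}(k,d)$ the number of $\pi\in\mathscr B_n$ with $\operatorname{pk}=k$, $\operatorname{des}=d$. These counts are $0$ if any argument is negative; for $n=0$ they are $1$ if all other arguments are $0$ and $0$ otherwise. $\binom{n}{m}=0$ unless $0\le m\le n$. $B^{(\mathrm{pk},\mathrm{des})}(x,y,t)=\sum_{n\ge0}\sum_{\pi\in\mathscr B_n}y^{\operatorname{pk}(\pi)}t^{\operatorname{des}(\pi)}\frac{x^n}{n!}$ and $P^{(\mathrm{pk},\mathrm{dp},\mathrm{des})}(x,y,z,t)=\sum_{n\ge0}\sum_{\pi\in\mathcal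 S_n}y^{\operatorname{pk}(\pi)}z^{\operatorname{dp}(\pi)}t^{\operatorname{des}(\pi)}\frac{x^n}{n!}$. -}

module Defs where

open import Data.Nat as ℕ using (ℕ; zero; suc; _<ᵇ_)
open import Data.Nat.Combinatorics using (_C_)
open import Data.Integer as ℤ using (ℤ; +_; -[1+_]; _-_; -_; _⊓_)
open import Data.Bool using (Bool; true; false; _∧_; if_then_else_)
open import Data.List using (List; []; _∷_; concatMap; map; filterᵇ; length; upTo)
open import Data.Nat.ListAction using (sum)
open import Relation.Nullary.Decidable using (does)
open import Relation.Binary.PropositionalEquality using (_≡_)

insertions : ℕ → List ℕ → List (List ℕ)
insertions x []       = (x ∷ []) ∷ []
insertions x (y ∷ ys) = (x ∷ y ∷ ys) ∷ map (y ∷_) (insertions x ys)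

S : ℕ → List (List ℕ)
S zero    = [] ∷ []
S (suc n) = concatMap (insertions (suc n)) (S n)

des : List ℕ → ℕ
des (a ∷ b ∷ xs) = (if b <ᵇ a then 1 else 0) ℕ.+ des (b ∷ xs)
des _            = 0

asc : List ℕ → ℕ
asc (a ∷ b ∷ xs) = (if a <ᵇ b then 1 else 0) ℕ.+ asc (b ∷ xs)
asc _            = 0

pk : List ℕ → ℕ
pk (a ∷ b ∷ c ∷ xs) = (if (a <ᵇ b) ∧ (c <ᵇ b) then 1 else 0) ℕ.+ pk (b ∷ c ∷ xs)
pk _                = 0

hgt : List ℕ → ℤ
hgt σ = + asc σ - + des σ

prefixes : List ℕ → List (List ℕ)
prefixes []       = []
prefixes (x ∷ xs) = (x ∷ []) ∷ map (x ∷_) (prefixes xs)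

minimum⁺ : ℤ → List ℤ → ℤ
minimum⁺ m []       = m
minimum⁺ m (y ∷ ys) = m ⊓ minimum⁺ y ys

dp : List ℕ → ℤ
dp π with map hgt (prefixes π)
... | []       = + 0
... | (y ∷ ys) = - minimum⁺ y ys

isBallot : List ℕ → Bool
isBallot π = allB (map hgt (prefixes π))
  where
  allB : List ℤ → Bool
  allB []       = true
  allB (y ∷ ys) = does (+ 0 ℤ.≤? y) ∧ allB ys

-- Counting functions (arguments in ℤ; zero when a size is negative)

eqℤ : ℤ → ℤ → Bool
eqℤ a b = does (a ℤ.≟ b)

count : (List ℕ → Bool) → List (List ℕ) → ℕ
count P xs = length (filterᵇ P xs)

p : ℤ → ℤ → ℤ → ℤ → ℕ
p (+ n)    k h d = count (λ π → eqℤ (+ pk π) k ∧ eqℤ (dp π) h ∧ eqℤ (+ des π) d) (S n)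
p -[1+ _ ] k h d = 0

b : ℤ → ℤ → ℤ → ℕ
b (+ n)    k d = count (λ π → isBallot π ∧ eqℤ (+ pk π) k ∧ eqℤ (+ des π) d) (S n)
b -[1+ _ ] k d = 0

-- binomial coefficient, zero unless 0 ≤ m ≤ n
binom : ℤ → ℤ → ℕ
binom (+ n) (+ m) = n C m
binom _     _     = 0

Σ≤ : ℕ → (ℕ → ℕ) → ℕ
Σ≤ N f = sum (map f (upTo (suc N)))

module Submission where

-- A permutation π is encoded by its up-down word (true for an ascent); des,
-- pk, dp and the ballot property of π are functions of this word, and
-- reversing π reverses and complements it.  Call a cut π = α β admissible
-- for (k, h, d) when reverse α and β are ballot, |α| = 2 des(reverse α) + h,
-- des(reverse α) + des β + h = d and pk(reverse α) + pk β = k: these are the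
-- cuts counted by the (i, j) term on the right, with i = des(reverse α).
-- Reading the word as a lattice path, exactly two cuts of π are admissible:
-- α ending where the path first attains its minimum (α empty if π is
-- ballot), admissible for (pk π, dp π, des π), and α ending where the
-- minimum is attained for the last time, admissible for
-- (pk π, dp π + 1, des π + 1).  This gives the left-hand side.  On the other
-- hand, a cut with |α| = m of a permutation of [n] amounts to the set of
-- values of α together with a permutation of that set and one of its
-- complement; as the statistics are invariant under order-preserving
-- relabelling, summing gives the binomial coefficient times the two ballot
-- counts.

open import Defs
open import Data.Nat as ℕ
  using (ℕ; zero; suc; _+_; _*_; _∸_; _≤_; _<_; z≤n; s≤s; _≡ᵇ_; _<ᵇ_; _≤ᵇ_; pred)
open import Data.Nat.Properties
open import Algebra.Properties.CommutativeSemigroup +-commutativeSemigroup using (interchange; xy∙z≈xz∙y)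
open import Data.Nat.Combinatorics using (_C_; k>n⇒nCk≡0; nCk+nC[k+1]≡[n+1]C[k+1])
open import Data.Nat.ListAction using (sum)
open import Data.Nat.Solver using (module +-*-Solver)
open import Data.Integer as ℤ using (ℤ; +_; -[1+_]; _⊓_; _-_)
import Data.Integer.Properties as ℤ
open import Data.Bool using (Bool; true; false; _∧_; not; if_then_else_; T)
open import Data.Bool.Properties using (∧-identityʳ; T-≡)
open import Data.List
  using (List; []; _∷_; _++_; length; reverse; map; _∷ʳ_; take; drop; concatMap; upTo; applyUpTo)
open import Data.List.Properties
  using ( ++-identityʳ; ++-assoc; unfold-reverse; map-++; map-∘; map-cong; map-id; take++drop≡id
        ; length-++; length-map; length-reverse; length-take)
open import Data.List.Relation.Unary.All as All using (All; []; _∷_)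
open import Data.List.Relation.Unary.All.Properties using (++⁺; map⁺; concat⁺)
open import Data.List.Relation.Unary.Any using (here; there)
open import Data.List.Membership.Propositional using (_∈_)
open import Data.Product using (_,_; _×_; proj₁)
open import Data.Empty using (⊥-elim)
open import Data.Unit using (⊤; tt)
open import Function using (_⇔_; mk⇔; Equivalence)
open import Relation.Nullary using (¬_; yes; no; Dec; _because_)
open import Relation.Nullary.Reflects using (invert)
open import Relation.Nullary.Decidable using (does)
open import Relation.Binary.Definitions using (tri<; tri≈; tri>)
open import Relation.Binary.PropositionalEquality

private
  variable
    X Y : Set

𝟙 : Bool → ℕ
𝟙 true  = 1
𝟙 false = 0

𝟙-∧ : ∀ a b → 𝟙 (a ∧ b) ≡ 𝟙 a * 𝟙 b
𝟙-∧ true  b = sym (+-identityʳ _)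
𝟙-∧ false b = refl

𝟙-split : ∀ c b → 𝟙 b ≡ 𝟙 (not c ∧ b) + 𝟙 (c ∧ b)
𝟙-split true  b = refl
𝟙-split false b = sym (+-identityʳ _)

T⇒≡true : ∀ {b} → T b → b ≡ true
T⇒≡true = Equivalence.to T-≡

¬T⇒≡false : ∀ {b} → ¬ T b → b ≡ false
¬T⇒≡false {true}  ¬t = ⊥-elim (¬t tt)
¬T⇒≡false {false} _  = refl

T-∧ : ∀ {a b} → T a → T b → T (a ∧ b)
T-∧ {true} {true} _ _ = tt

T-∧ˡ : ∀ {a b} → T (a ∧ b) → T a
T-∧ˡ {true} _ = tt

T-∧ʳ : ∀ {a b} → T (a ∧ b) → T b
T-∧ʳ {true} t = t

T-injective : ∀ {a b} → (T a → T b) → (T b → T a) → a ≡ b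
T-injective {true}  {true}  _ _ = refl
T-injective {true}  {false} f _ = ⊥-elim (f tt)
T-injective {false} {true}  _ g = ⊥-elim (g tt)
T-injective {false} {false} _ _ = refl

does-sound : ∀ {A : Set} (a? : Dec A) → T (does a?) → A
does-sound (true because [a]) _ = invert [a]

does-complete : ∀ {A : Set} (a? : Dec A) → A → T (does a?)
does-complete (true  because _)    _ = tt
does-complete (false because [¬a]) a = ⊥-elim (invert [¬a] a)

<ᵇ-flip : ∀ a b → a ≢ b → (b <ᵇ a) ≡ not (a <ᵇ b)
<ᵇ-flip a b a≢b with <-cmp a b
... | tri< a<b _ _ = trans (¬T⇒≡false (λ t → <-asym a<b (<ᵇ⇒< b a t))) (cong not (sym (T⇒≡true (<⇒<ᵇ a<b))))
... | tri≈ _ a≡b _ = ⊥-elim (a≢b a≡b)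
... | tri> _ _ a>b = trans (T⇒≡true (<⇒<ᵇ a>b)) (cong not (sym (¬T⇒≡false (λ t → <-asym a>b (<ᵇ⇒< a b t)))))

<ᵇ-irrefl : ∀ a → (a <ᵇ a) ≡ false
<ᵇ-irrefl a = ¬T⇒≡false (λ t → <-irrefl refl (<ᵇ⇒< a a t))

≡ᵇ-refl : ∀ u → (u ≡ᵇ u) ≡ true
≡ᵇ-refl zero    = refl
≡ᵇ-refl (suc u) = ≡ᵇ-refl u

<⇒≡ᵇ-false : ∀ {x u} → x < u → (x ≡ᵇ u) ≡ false
<⇒≡ᵇ-false {x} {u} x<u = ¬T⇒≡false (λ t → <-irrefl (≡ᵇ⇒≡ x u t) x<u)

eqℤ-∸ : ∀ (u : ℤ) j (v : ℤ) → eqℤ u (v - + j) ≡ eqℤ (u ℤ.+ + j) v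
eqℤ-∸ u j v = T-injective
  (λ t → does-complete ((u ℤ.+ + j) ℤ.≟ v) (to (does-sound (u ℤ.≟ (v - + j)) t)))
  (λ t → does-complete (u ℤ.≟ (v - + j)) (from (does-sound ((u ℤ.+ + j) ℤ.≟ v) t)))
  where
  cancel : ∀ w → w - + j ℤ.+ + j ≡ w
  cancel w = trans (ℤ.+-assoc w (ℤ.- + j) (+ j)) (trans (cong (λ z → w ℤ.+ z) (ℤ.+-inverseˡ (+ j))) (ℤ.+-identityʳ w))
  cancel′ : ∀ w → w ℤ.+ + j - + j ≡ w
  cancel′ w = trans (ℤ.+-assoc w (+ j) (ℤ.- + j)) (trans (cong (λ z → w ℤ.+ z) (ℤ.+-inverseʳ (+ j))) (ℤ.+-identityʳ w))
  to : u ≡ v - + j → u ℤ.+ + j ≡ v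
  to refl = cancel v
  from : u ℤ.+ + j ≡ v → u ≡ v - + j
  from refl = sym (cancel′ u)

eqℤ-+-∸ : ∀ x k j → eqℤ (+ x) (+ k - + j) ≡ (x + j ≡ᵇ k)
eqℤ-+-∸ x k j = trans (eqℤ-∸ (+ x) j (+ k)) (cong (λ z → eqℤ z (+ k)) (sym (ℤ.pos-+ x j)))

eqℤ-+-∸-∸ : ∀ x d i h → eqℤ (+ x) (+ d - + i - + h) ≡ (x + i + h ≡ᵇ d)
eqℤ-+-∸-∸ x d i h = begin
  eqℤ (+ x) (+ d - + i - + h)     ≡⟨ eqℤ-∸ (+ x) h (+ d - + i) ⟩
  eqℤ (+ x ℤ.+ + h) (+ d - + i)   ≡⟨ cong (λ z → eqℤ z (+ d - + i)) (sym (ℤ.pos-+ x h)) ⟩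
  eqℤ (+ (x + h)) (+ d - + i)     ≡⟨ eqℤ-+-∸ (x + h) d i ⟩
  (x + h + i ≡ᵇ d)                ≡⟨ cong (_≡ᵇ d) (xy∙z≈xz∙y x h i) ⟩
  (x + i + h ≡ᵇ d)                ∎
  where open ≡-Reasoning

+-pos-∸ : ∀ n m → m ≤ n → + n - + m ≡ + (n ∸ m)
+-pos-∸ n m m≤n = trans (ℤ.m-n≡m⊖n n m) (ℤ.⊖-≥ m≤n)

∑ : List X → (X → ℕ) → ℕ
∑ []       f = 0
∑ (x ∷ xs) f = f x + ∑ xs f

∑< : ℕ → (ℕ → ℕ) → ℕ
∑< zero    f = 0
∑< (suc n) f = f 0 + ∑< n (λ i → f (suc i))

∑-cong : ∀ (xs : List X) {f g} → (∀ x → f x ≡ g x) → ∑ xs f ≡ ∑ xs g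
∑-cong []       e = refl
∑-cong (x ∷ xs) e = cong₂ _+_ (e x) (∑-cong xs e)

∑-congᴬ : ∀ {P : X → Set} (xs : List X) {f g : X → ℕ} →
  All P xs → (∀ x → P x → f x ≡ g x) → ∑ xs f ≡ ∑ xs g
∑-congᴬ []       []       e = refl
∑-congᴬ (x ∷ xs) (p ∷ ps) e = cong₂ _+_ (e x p) (∑-congᴬ xs ps e)

∑-zero : ∀ (xs : List X) → ∑ xs (λ _ → 0) ≡ 0
∑-zero []       = refl
∑-zero (x ∷ xs) = ∑-zero xs

∑-const : ∀ (xs : List X) c → ∑ xs (λ _ → c) ≡ length xs * c
∑-const []       c = refl
∑-const (x ∷ xs) c = cong (_+_ c) (∑-const xs c)

∑-+ : ∀ (xs : List X) f g → ∑ xs (λ x → f x + g x) ≡ ∑ xs f + ∑ xs g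
∑-+ []       f g = refl
∑-+ (x ∷ xs) f g = trans (cong (_+_ (f x + g x)) (∑-+ xs f g)) (interchange (f x) (g x) _ _)

∑-*ˡ : ∀ (xs : List X) c f → ∑ xs (λ x → c * f x) ≡ c * ∑ xs f
∑-*ˡ []       c f = sym (*-zeroʳ c)
∑-*ˡ (x ∷ xs) c f = trans (cong (_+_ (c * f x)) (∑-*ˡ xs c f)) (sym (*-distribˡ-+ c (f x) _))

∑-*ʳ : ∀ (xs : List X) c f → ∑ xs (λ x → f x * c) ≡ ∑ xs f * c
∑-*ʳ xs c f = trans (∑-cong xs (λ x → *-comm (f x) c)) (trans (∑-*ˡ xs c f) (*-comm c _))

∑-++ : ∀ (xs ys : List X) f → ∑ (xs ++ ys) f ≡ ∑ xs f + ∑ ys f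
∑-++ []       ys f = refl
∑-++ (x ∷ xs) ys f = trans (cong (_+_ (f x)) (∑-++ xs ys f)) (sym (+-assoc (f x) _ _))

∑-map : ∀ (g : X → Y) xs f → ∑ (map g xs) f ≡ ∑ xs (λ x → f (g x))
∑-map g []       f = refl
∑-map g (x ∷ xs) f = cong (_+_ (f (g x))) (∑-map g xs f)

∑-concatMap : ∀ (g : X → List Y) xs f → ∑ (concatMap g xs) f ≡ ∑ xs (λ x → ∑ (g x) f)
∑-concatMap g []       f = refl
∑-concatMap g (x ∷ xs) f = trans (∑-++ (g x) (concatMap g xs) f) (cong (_+_ (∑ (g x) f)) (∑-concatMap g xs f))

∑-swap : ∀ (xs : List X) (ys : List Y) (f : X → Y → ℕ) →
  ∑ xs (λ x → ∑ ys (f x)) ≡ ∑ ys (λ y → ∑ xs (λ x → f x y))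
∑-swap []       ys f = sym (∑-zero ys)
∑-swap (x ∷ xs) ys f = trans (cong (_+_ (∑ ys (f x))) (∑-swap xs ys f)) (sym (∑-+ ys (f x) _))

∑-sum-map : ∀ (xs : List X) f → sum (map f xs) ≡ ∑ xs f
∑-sum-map []       f = refl
∑-sum-map (x ∷ xs) f = cong (_+_ (f x)) (∑-sum-map xs f)

∑-applyUpTo : ∀ (g : ℕ → ℕ) n f → ∑ (applyUpTo g n) f ≡ ∑< n (λ i → f (g i))
∑-applyUpTo g zero    f = refl
∑-applyUpTo g (suc n) f = cong (_+_ (f (g 0))) (∑-applyUpTo (λ i → g (suc i)) n f)

∑<-cong : ∀ n {f g : ℕ → ℕ} → (∀ i → f i ≡ g i) → ∑< n f ≡ ∑< n g
∑<-cong zero    e = refl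
∑<-cong (suc n) e = cong₂ _+_ (e 0) (∑<-cong n (λ i → e (suc i)))

∑<-congᴮ : ∀ n {f g : ℕ → ℕ} → (∀ i → i < n → f i ≡ g i) → ∑< n f ≡ ∑< n g
∑<-congᴮ zero    e = refl
∑<-congᴮ (suc n) e = cong₂ _+_ (e 0 (s≤s z≤n)) (∑<-congᴮ n (λ i i<n → e (suc i) (s≤s i<n)))

∑<-zero : ∀ n → ∑< n (λ _ → 0) ≡ 0
∑<-zero zero    = refl
∑<-zero (suc n) = ∑<-zero n

∑<-+ : ∀ n f g → ∑< n (λ i → f i + g i) ≡ ∑< n f + ∑< n g
∑<-+ zero    f g = refl
∑<-+ (suc n) f g = trans (cong (_+_ (f 0 + g 0)) (∑<-+ n _ _)) (interchange (f 0) (g 0) _ _)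

∑<-*ˡ : ∀ n c f → ∑< n (λ i → c * f i) ≡ c * ∑< n f
∑<-*ˡ zero    c f = sym (*-zeroʳ c)
∑<-*ˡ (suc n) c f = trans (cong (_+_ (c * f 0)) (∑<-*ˡ n c _)) (sym (*-distribˡ-+ c (f 0) _))

∑<-swap : ∀ n m (f : ℕ → ℕ → ℕ) → ∑< n (λ i → ∑< m (f i)) ≡ ∑< m (λ j → ∑< n (λ i → f i j))
∑<-swap zero    m f = sym (∑<-zero m)
∑<-swap (suc n) m f = trans (cong (_+_ (∑< m (f 0))) (∑<-swap n m _)) (sym (∑<-+ m (f 0) _))

∑<-∑-swap : ∀ n (xs : List X) (f : ℕ → X → ℕ) →
  ∑< n (λ i → ∑ xs (f i)) ≡ ∑ xs (λ x → ∑< n (λ i → f i x))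
∑<-∑-swap zero    xs f = sym (∑-zero xs)
∑<-∑-swap (suc n) xs f = trans (cong (_+_ (∑ xs (f 0))) (∑<-∑-swap n xs _)) (sym (∑-+ xs (f 0) _))

∑-∑<²-swap : ∀ (xs : List X) N K (f : ℕ → ℕ → X → ℕ) →
  ∑ xs (λ x → ∑< N (λ i → ∑< K (λ j → f i j x))) ≡ ∑< N (λ i → ∑< K (λ j → ∑ xs (f i j)))
∑-∑<²-swap xs N K f = trans (sym (∑<-∑-swap N xs (λ i x → ∑< K (λ j → f i j x))))
  (∑<-cong N (λ i → sym (∑<-∑-swap K xs (f i))))

∑<-indicator : ∀ n a f → ∑< n (λ i → 𝟙 (a ≡ᵇ i) * f i) ≡ 𝟙 (a <ᵇ n) * f a
∑<-indicator zero    a       f = refl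
∑<-indicator (suc n) zero    f = begin
  f 0 + 0 + ∑< n (λ i → 0 * f (suc i))  ≡⟨ cong₂ _+_ (+-identityʳ (f 0)) (∑<-zero n) ⟩
  f 0 + 0                               ∎
  where open ≡-Reasoning
∑<-indicator (suc n) (suc a) f = ∑<-indicator n a (λ i → f (suc i))

∑<-pair-indicator : ∀ a b k → ∑< (suc k) (λ j → 𝟙 (a ≡ᵇ j) * 𝟙 (b + j ≡ᵇ k)) ≡ 𝟙 (a + b ≡ᵇ k)
∑<-pair-indicator a b k = trans (∑<-indicator (suc k) a (λ j → 𝟙 (b + j ≡ᵇ k))) (bounded a b)
  where
  bounded : ∀ a b → 𝟙 (a <ᵇ suc k) * 𝟙 (b + a ≡ᵇ k) ≡ 𝟙 (a + b ≡ᵇ k)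
  bounded a b with a <ᵇ suc k in a≤k
  ... | true  = trans (+-identityʳ _) (cong (λ z → 𝟙 (z ≡ᵇ k)) (+-comm b a))
  ... | false = sym (cong 𝟙 (¬T⇒≡false (λ t → a+b≢k (≡ᵇ⇒≡ _ _ t))))
    where
    a+b≢k : a + b ≢ k
    a+b≢k e = subst T a≤k (<⇒<ᵇ (s≤s (subst (a ≤_) e (m≤m+n a b))))

∑<-reindex : ∀ n K (g : ℕ → ℕ) (F : ℕ → ℕ → ℕ → ℕ) →
  ∑< (suc n) (λ i → ∑< K (λ j → 𝟙 (g i ≤ᵇ n) * F (g i) i j))
    ≡ ∑< (suc n) (λ m → ∑< (suc n) (λ i → ∑< K (λ j → 𝟙 (g i ≡ᵇ m) * F m i j)))
∑<-reindex n K g F = sym (begin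
  ∑< (suc n) (λ m → ∑< (suc n) (λ i → ∑< K (λ j → 𝟙 (g i ≡ᵇ m) * F m i j)))
    ≡⟨ ∑<-swap (suc n) (suc n) (λ m i → ∑< K (λ j → 𝟙 (g i ≡ᵇ m) * F m i j)) ⟩
  ∑< (suc n) (λ i → ∑< (suc n) (λ m → ∑< K (λ j → 𝟙 (g i ≡ᵇ m) * F m i j)))
    ≡⟨ ∑<-cong (suc n) (λ i → ∑<-swap (suc n) K (λ m j → 𝟙 (g i ≡ᵇ m) * F m i j)) ⟩
  ∑< (suc n) (λ i → ∑< K (λ j → ∑< (suc n) (λ m → 𝟙 (g i ≡ᵇ m) * F m i j)))
    ≡⟨ ∑<-cong (suc n) (λ i → ∑<-cong K (λ j → ∑<-indicator (suc n) (g i) (λ m → F m i j))) ⟩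
  ∑< (suc n) (λ i → ∑< K (λ j → 𝟙 (g i <ᵇ suc n) * F (g i) i j))
    ≡⟨ ∑<-cong (suc n) (λ i → ∑<-cong K (λ j → cong (λ b → 𝟙 b * F (g i) i j) (<ᵇ-suc (g i)))) ⟩
  ∑< (suc n) (λ i → ∑< K (λ j → 𝟙 (g i ≤ᵇ n) * F (g i) i j)) ∎)
  where
  open ≡-Reasoning
  <ᵇ-suc : ∀ a → (a <ᵇ suc n) ≡ (a ≤ᵇ n)
  <ᵇ-suc zero    = refl
  <ᵇ-suc (suc a) = refl

Σ≤-∑< : ∀ N f → Σ≤ N f ≡ ∑< (suc N) f
Σ≤-∑< N f = trans (∑-sum-map (upTo (suc N)) f) (∑-applyUpTo (λ i → i) (suc N) f)

Σ≤²-∑<² : ∀ N K (f : ℕ → ℕ → ℕ) → Σ≤ N (λ i → Σ≤ K (f i)) ≡ ∑< (suc N) (λ i → ∑< (suc K) (f i))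
Σ≤²-∑<² N K f = trans (Σ≤-∑< N _) (∑<-cong (suc N) (λ i → Σ≤-∑< K (f i)))

-- Up-down words

-- A word w : List Bool is read as a lattice path, true being an up step.
-- ballotFrom s w: started at height s, the path never goes below 0.
-- endsOnFloor s w: started at s, with down steps at height 0 suppressed, the
-- path ends at 0; for s = 0 this says that the endpoint of w is a minimum.
-- hitsFloor s w: started at s, the path reaches 0.
-- depth w: how far the path goes below its starting height.

ups downs : List Bool → ℕ
ups []          = 0
ups (true ∷ w)  = suc (ups w)
ups (false ∷ w) = ups w
downs []          = 0
downs (true ∷ w)  = downs w
downs (false ∷ w) = suc (downs w)

peakAt : Bool → List Bool → ℕ
peakAt _     []          = 0
peakAt _     (true ∷ _)  = 0
peakAt true  (false ∷ _) = 1
peakAt false (false ∷ _) = 0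

peaks : List Bool → ℕ
peaks []      = 0
peaks (c ∷ w) = peakAt c w + peaks w

depth : List Bool → ℕ
depth []          = 0
depth (true ∷ w)  = pred (depth w)
depth (false ∷ w) = suc (depth w)

ballotFrom : ℕ → List Bool → Bool
ballotFrom s       []          = true
ballotFrom s       (true ∷ w)  = ballotFrom (suc s) w
ballotFrom zero    (false ∷ w) = false
ballotFrom (suc s) (false ∷ w) = ballotFrom s w

floorStep : ℕ → Bool → ℕ
floorStep s true  = suc s
floorStep s false = pred s

endsOnFloor : ℕ → List Bool → Bool
endsOnFloor s []      = s ≡ᵇ 0
endsOnFloor s (c ∷ w) = endsOnFloor (floorStep s c) w

hitsFloor : ℕ → List Bool → Bool
hitsFloor zero    w           = true
hitsFloor (suc s) []          = false
hitsFloor (suc s) (true ∷ w)  = hitsFloor (suc (suc s)) w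
hitsFloor (suc s) (false ∷ w) = hitsFloor s w

hitsFloor-suc : ∀ s w → hitsFloor (suc s) w ≡ not (ballotFrom s w)
hitsFloor-suc s       []          = refl
hitsFloor-suc s       (true ∷ w)  = hitsFloor-suc (suc s) w
hitsFloor-suc zero    (false ∷ w) = refl
hitsFloor-suc (suc s) (false ∷ w) = hitsFloor-suc s w

length≡ups+downs : ∀ w → length w ≡ ups w + downs w
length≡ups+downs []          = refl
length≡ups+downs (true ∷ w)  = cong suc (length≡ups+downs w)
length≡ups+downs (false ∷ w) = trans (cong suc (length≡ups+downs w)) (sym (+-suc (ups w) (downs w)))

downs-++ : ∀ u v → downs (u ++ v) ≡ downs u + downs v
downs-++ []          v = refl
downs-++ (true ∷ u)  v = downs-++ u v
downs-++ (false ∷ u) v = cong suc (downs-++ u v)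

∑cuts : List Bool → (List Bool → Bool → List Bool → ℕ) → ℕ
∑cuts []      G = 0
∑cuts (c ∷ w) G = G [] c w + ∑cuts w (λ u c′ v → G (c ∷ u) c′ v)

∑cuts-cong : ∀ w {G₁ G₂ : List Bool → Bool → List Bool → ℕ} →
  (∀ u c v → G₁ u c v ≡ G₂ u c v) → ∑cuts w G₁ ≡ ∑cuts w G₂
∑cuts-cong []      e = refl
∑cuts-cong (c ∷ w) e = cong₂ _+_ (e [] c w) (∑cuts-cong w (λ u c′ v → e (c ∷ u) c′ v))

∑cuts-+ : ∀ w (G₁ G₂ : List Bool → Bool → List Bool → ℕ) →
  ∑cuts w (λ u c v → G₁ u c v + G₂ u c v) ≡ ∑cuts w G₁ + ∑cuts w G₂
∑cuts-+ []      G₁ G₂ = refl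
∑cuts-+ (c ∷ w) G₁ G₂ =
  trans (cong (_+_ (G₁ [] c w + G₂ [] c w)) (∑cuts-+ w _ _)) (interchange (G₁ [] c w) (G₂ [] c w) _ _)

-- Started at height s, either the path never goes below 0, or there is exactly
-- one cut w = u ++ false ∷ v at which it first reaches its (negative) minimum.
first-minimum-cut : ∀ s w (G₀ : ℕ) (G : List Bool → List Bool → ℕ) R →
  (ballotFrom s w ≡ true → G₀ ≡ R) →
  (∀ u v → u ++ false ∷ v ≡ w → endsOnFloor s u ≡ true → ballotFrom 0 v ≡ true → G u v ≡ R) →
  𝟙 (ballotFrom s w) * G₀ + ∑cuts w (λ u c v → 𝟙 (not c ∧ endsOnFloor s u ∧ ballotFrom 0 v) * G u v) ≡ R
first-minimum-cut s [] G₀ G R whole atCut = trans (+-identityʳ _) (trans (+-identityʳ G₀) (whole refl))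
first-minimum-cut s (true ∷ w) G₀ G R whole atCut =
  first-minimum-cut (suc s) w G₀ (λ u v → G (true ∷ u) v) R whole
    (λ u v e → atCut (true ∷ u) v (cong (true ∷_) e))
first-minimum-cut (suc s) (false ∷ w) G₀ G R whole atCut =
  first-minimum-cut s w G₀ (λ u v → G (false ∷ u) v) R whole
    (λ u v e → atCut (false ∷ u) v (cong (false ∷_) e))
first-minimum-cut zero (false ∷ w) G₀ G R whole atCut =
  first-minimum-cut zero w (G [] w) (λ u v → G (false ∷ u) v) R (atCut [] w refl refl)
    (λ u v e → atCut (false ∷ u) v (cong (false ∷_) e))

-- Dually, if the path started at s reaches 0, exactly one term survives: the
-- cut w = u ++ true ∷ v leaving the last minimum, or the end of w if the
-- minimum is attained there.
last-minimum-cut : ∀ s w (G₁ : ℕ) (G : List Bool → List Bool → ℕ) R →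
  (endsOnFloor s w ≡ true → G₁ ≡ R) →
  (∀ u v → u ++ true ∷ v ≡ w → endsOnFloor s u ≡ true → ballotFrom 0 v ≡ true → G u v ≡ R) →
  ∑cuts w (λ u c v → 𝟙 (c ∧ endsOnFloor s u ∧ ballotFrom 0 v) * G u v) + 𝟙 (endsOnFloor s w) * G₁
    ≡ 𝟙 (hitsFloor s w) * R
last-minimum-cut zero [] G₁ G R whole atCut = cong (_+ 0) (whole refl)
last-minimum-cut (suc s) [] G₁ G R whole atCut = refl
last-minimum-cut s (false ∷ w) G₁ G R whole atCut =
  trans (last-minimum-cut (pred s) w G₁ (λ u v → G (false ∷ u) v) R whole
          (λ u v e → atCut (false ∷ u) v (cong (false ∷_) e)))
        (cong (λ b → 𝟙 b * R) (hitsFloor-down s w))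
  where
  hitsFloor-down : ∀ s w → hitsFloor (pred s) w ≡ hitsFloor s (false ∷ w)
  hitsFloor-down zero    w = refl
  hitsFloor-down (suc s) w = refl
last-minimum-cut (suc s) (true ∷ w) G₁ G R whole atCut =
  last-minimum-cut (suc (suc s)) w G₁ (λ u v → G (true ∷ u) v) R whole
    (λ u v e → atCut (true ∷ u) v (cong (true ∷_) e))
last-minimum-cut zero (true ∷ w) G₁ G R whole atCut = begin
  𝟙 (ballotFrom 0 w) * G [] w + ∑cuts w later + 𝟙 (endsOnFloor 1 w) * G₁
    ≡⟨ +-assoc (𝟙 (ballotFrom 0 w) * G [] w) _ _ ⟩
  𝟙 (ballotFrom 0 w) * G [] w + (∑cuts w later + 𝟙 (endsOnFloor 1 w) * G₁)
    ≡⟨ cong (_+_ (𝟙 (ballotFrom 0 w) * G [] w))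
         (last-minimum-cut 1 w G₁ (λ u v → G (true ∷ u) v) R whole
           (λ u v e → atCut (true ∷ u) v (cong (true ∷_) e))) ⟩
  𝟙 (ballotFrom 0 w) * G [] w + 𝟙 (hitsFloor 1 w) * R
    ≡⟨ cong (λ b → 𝟙 (ballotFrom 0 w) * G [] w + 𝟙 b * R) (hitsFloor-suc 0 w) ⟩
  𝟙 (ballotFrom 0 w) * G [] w + 𝟙 (not (ballotFrom 0 w)) * R
    ≡⟨ exactly-one (ballotFrom 0 w) refl ⟩
  R + 0 ∎
  where
  open ≡-Reasoning
  later : List Bool → Bool → List Bool → ℕ
  later u c v = 𝟙 (c ∧ endsOnFloor 1 u ∧ ballotFrom 0 v) * G (true ∷ u) v
  exactly-one : ∀ b → ballotFrom 0 w ≡ b → 𝟙 b * G [] w + 𝟙 (not b) * R ≡ R + 0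
  exactly-one true  e = trans (+-identityʳ _) (cong (_+ 0) (atCut [] w refl refl e))
  exactly-one false e = refl

-- The endpoint of u is its minimum, so the depth of u ++ z is governed by z.
depth-++ : ∀ s u z → endsOnFloor s u ≡ true →
  (depth (u ++ z) + ups u ≡ downs u + depth z) × (ups u + s ≤ downs u)
depth-++ zero    []          z _ = +-identityʳ _ , z≤n
depth-++ s       (true ∷ u)  z on with depth-++ (suc s) u z on
... | e , b = lower (depth (u ++ z)) e , subst (_≤ downs u) (+-suc (ups u) s) b
  where
  lower : ∀ D → D + ups u ≡ downs u + depth z → pred D + suc (ups u) ≡ downs u + depth z
  lower zero    e₀ = ⊥-elim (<-irrefl refl (begin-strict
    ups u              <⟨ n<1+n (ups u) ⟩
    suc (ups u)        ≤⟨ s≤s (m≤m+n (ups u) s) ⟩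
    suc (ups u) + s    ≡⟨ sym (+-suc (ups u) s) ⟩
    ups u + suc s      ≤⟨ b ⟩
    downs u            ≤⟨ m≤m+n (downs u) (depth z) ⟩
    downs u + depth z  ≡⟨ sym e₀ ⟩
    ups u              ∎))
    where open ≤-Reasoning
  lower (suc D) e₀ = trans (+-suc D (ups u)) e₀
depth-++ zero    (false ∷ u) z on with depth-++ zero u z on
... | e , b = cong suc e , ≤-trans b (n≤1+n _)
depth-++ (suc s) (false ∷ u) z on with depth-++ s u z on
... | e , b = cong suc e , subst (_≤ suc (downs u)) (sym (+-suc (ups u) s)) (s≤s b)

ballotFrom⇒depth≤ : ∀ s w → ballotFrom s w ≡ true → depth w ≤ s
ballotFrom⇒depth≤ s       []          _ = z≤n
ballotFrom⇒depth≤ s       (true ∷ w)  b = pred-mono-≤ (ballotFrom⇒depth≤ (suc s) w b)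
ballotFrom⇒depth≤ (suc s) (false ∷ w) b = s≤s (ballotFrom⇒depth≤ s w b)

ballot⇒depth≡0 : ∀ w → ballotFrom 0 w ≡ true → depth w ≡ 0
ballot⇒depth≡0 w b = n≤0⇒n≡0 (ballotFrom⇒depth≤ 0 w b)

peakAt-cong : ∀ b b′ (w w′ : List Bool) → peakAt b (b′ ∷ w) ≡ peakAt b (b′ ∷ w′)
peakAt-cong b     true  w w′ = refl
peakAt-cong true  false w w′ = refl
peakAt-cong false false w w′ = refl

peakAt-false : ∀ w → peakAt false w ≡ 0
peakAt-false []          = refl
peakAt-false (true ∷ w)  = refl
peakAt-false (false ∷ w) = refl

-- u is empty or ends with a down step, and v is empty or starts with an up
-- step, so no peak sits at the cut.
peaks-++-cut : ∀ s u c v → endsOnFloor s u ≡ true → ballotFrom 0 v ≡ true →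
  peaks (u ++ c ∷ v) ≡ peaks u + peaks v
peaks-++-cut s []              c []          _  _  = refl
peaks-++-cut s []              c (true ∷ v)  _  _  = refl
peaks-++-cut s []              c (false ∷ v) _  ()
peaks-++-cut s (true ∷ [])     c v           () _
peaks-++-cut s (false ∷ [])    c v           on bv =
  trans (cong (_+ peaks (c ∷ v)) (peakAt-false (c ∷ v))) (peaks-++-cut (pred s) [] c v on bv)
peaks-++-cut s (b ∷ b′ ∷ u)    c v           on bv = begin
  peakAt b (b′ ∷ u ++ c ∷ v) + peaks (b′ ∷ u ++ c ∷ v)
    ≡⟨ cong₂ _+_ (peakAt-cong b b′ _ _) (peaks-++-cut (floorStep s b) (b′ ∷ u) c v on bv) ⟩
  peakAt b (b′ ∷ u) + (peaks (b′ ∷ u) + peaks v)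
    ≡⟨ sym (+-assoc (peakAt b (b′ ∷ u)) _ _) ⟩
  peakAt b (b′ ∷ u) + peaks (b′ ∷ u) + peaks v ∎
  where open ≡-Reasoning

allEq : ℕ → ℕ → ℕ → ℕ → ℕ → ℕ → Bool
allEq x₁ y₁ x₂ y₂ x₃ y₃ = (x₁ ≡ᵇ y₁) ∧ (x₂ ≡ᵇ y₂) ∧ (x₃ ≡ᵇ y₃)

allEq-cong : ∀ {x₁ y₁ x₂ y₂ x₃ y₃ p₁ q₁ p₂ q₂ p₃ q₃} →
  (x₁ ≡ y₁ → x₂ ≡ y₂ → x₃ ≡ y₃ → (p₁ ≡ q₁) × (p₂ ≡ q₂) × (p₃ ≡ q₃)) →
  (p₁ ≡ q₁ → p₂ ≡ q₂ → p₃ ≡ q₃ → (x₁ ≡ y₁) × (x₂ ≡ y₂) × (x₃ ≡ y₃)) →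
  allEq x₁ y₁ x₂ y₂ x₃ y₃ ≡ allEq p₁ q₁ p₂ q₂ p₃ q₃
allEq-cong to from =
  T-injective (λ t → triple (uncurry³ to (untriple t))) (λ t → triple (uncurry³ from (untriple t)))
  where
  untriple : ∀ {a b c d e f} → T (allEq a b c d e f) → (a ≡ b) × (c ≡ d) × (e ≡ f)
  untriple {a} {b} {c} {d} {e} {f} t =
    ≡ᵇ⇒≡ a b (T-∧ˡ t) , ≡ᵇ⇒≡ c d (T-∧ˡ (T-∧ʳ {a ≡ᵇ b} t)) , ≡ᵇ⇒≡ e f (T-∧ʳ (T-∧ʳ {a ≡ᵇ b} t))
  triple : ∀ {a b c d e f} → (a ≡ b) × (c ≡ d) × (e ≡ f) → T (allEq a b c d e f)
  triple {a} {b} {c} {d} {e} {f} (e₁ , e₂ , e₃) = T-∧ (≡⇒≡ᵇ a b e₁) (T-∧ (≡⇒≡ᵇ c d e₂) (≡⇒≡ᵇ e f e₃))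
  uncurry³ : ∀ {A B C D : Set} → (A → B → C → D) → A × B × C → D
  uncurry³ g (a , b , c) = g a b c

2*t+h≡1+t+f⇔t+h≡1+f : ∀ t h f → (2 * t + h ≡ suc (t + f)) ⇔ (t + h ≡ suc f)
2*t+h≡1+t+f⇔t+h≡1+f t h f = mk⇔
  (λ e → +-cancelˡ-≡ t _ _ (trans (sym (2*t+h≡t+[t+h] t h)) (trans e (sym (+-suc t f)))))
  (λ e → trans (2*t+h≡t+[t+h] t h) (trans (cong (_+_ t) e) (+-suc t f)))
  where
  2*t+h≡t+[t+h] : ∀ t h → 2 * t + h ≡ t + (t + h)
  2*t+h≡t+[t+h] t h = trans (cong (λ z → t + z + h) (+-identityʳ t)) (+-assoc t t h)

-- cutWeight is the indicator of admissibility of a cut π = α β, given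
-- ballotness, descents and peaks of reverse α and of β, and |α|.
module CutWeight (h d k : ℕ) where

  cutWeight : Bool → ℕ → ℕ → Bool → ℕ → ℕ → ℕ → ℕ
  cutWeight bα dα pα bβ dβ pβ m = 𝟙 (bα ∧ bβ) * 𝟙 (allEq (2 * dα + h) m (dβ + dα + h) d (pα + pβ) k)

  startWeight endWeight : List Bool → ℕ
  startWeight w = cutWeight true 0 0 (ballotFrom 0 w) (downs w) (peaks w) 0
  endWeight   w = cutWeight (endsOnFloor 0 w) (ups w) (peaks w) true 0 0 (suc (length w))

  middleWeight : List Bool → List Bool → ℕ
  middleWeight u v =
    cutWeight (endsOnFloor 0 u) (ups u) (peaks u) (ballotFrom 0 v) (downs v) (peaks v) (suc (length u))

  -- match⁻ tests the statistics against (k, h - 1, d - 1), avoiding subtraction.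
  match match⁻ : List Bool → ℕ
  match  w = 𝟙 (allEq (peaks w) k (depth w) h (downs w) d)
  match⁻ w = 𝟙 (allEq (peaks w) k (suc (depth w)) h (suc (downs w)) d)

  cutMatch : List Bool → List Bool → ℕ
  cutMatch u v = 𝟙 (allEq (2 * ups u + h) (suc (length u)) (downs v + ups u + h) d (peaks u + peaks v) k)

  allEq-cut : ∀ {ℓ t f g P P′ D F} → ℓ ≡ t + f → P′ ≡ P → D + t ≡ suc f → F ≡ suc (f + g) →
    allEq (2 * t + h) (suc ℓ) (g + t + h) d P k ≡ allEq P′ k D h F d
  allEq-cut {ℓ} {t} {f} {g} {P} {P′} {D} {F} refl refl D+t≡1+f F≡1+f+g = allEq-cong forward backward
    where
    open Equivalence (2*t+h≡1+t+f⇔t+h≡1+f t h f)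
    D≡h : t + h ≡ suc f → D ≡ h
    D≡h th = +-cancelʳ-≡ t D h (trans D+t≡1+f (trans (sym th) (+-comm t h)))
    t+h≡1+f : D ≡ h → t + h ≡ suc f
    t+h≡1+f D≡h = trans (cong (_+_ t) (sym D≡h)) (trans (+-comm t D) D+t≡1+f)
    downs-match : t + h ≡ suc f → g + t + h ≡ F
    downs-match th = begin
      g + t + h      ≡⟨ +-assoc g t h ⟩
      g + (t + h)    ≡⟨ cong (_+_ g) th ⟩
      g + suc f      ≡⟨ +-suc g f ⟩
      suc (g + f)    ≡⟨ cong suc (+-comm g f) ⟩
      suc (f + g)    ≡⟨ sym F≡1+f+g ⟩
      F              ∎
      where open ≡-Reasoning
    forward : 2 * t + h ≡ suc ℓ → g + t + h ≡ d → P ≡ k → (P′ ≡ k) × (D ≡ h) × (F ≡ d)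
    forward e₁ e₂ e₃ = e₃ , D≡h (to e₁) , trans (sym (downs-match (to e₁))) e₂
    backward : P′ ≡ k → D ≡ h → F ≡ d → (2 * t + h ≡ suc ℓ) × (g + t + h ≡ d) × (P ≡ k)
    backward e₁ e₂ e₃ = from (t+h≡1+f e₂) , trans (downs-match (t+h≡1+f e₂)) e₃ , e₁

  cutMatch-first : ∀ u v → endsOnFloor 0 u ≡ true → ballotFrom 0 v ≡ true →
    cutMatch u v ≡ match (u ++ false ∷ v)
  cutMatch-first u v on bv = cong 𝟙 (allEq-cut (length≡ups+downs u) (peaks-++-cut 0 u false v on bv)
    (trans (proj₁ (depth-++ 0 u (false ∷ v) on))
           (trans (cong (λ z → downs u + suc z) (ballot⇒depth≡0 v bv)) (+-comm (downs u) 1)))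
    (trans (downs-++ u (false ∷ v)) (+-suc (downs u) (downs v))))

  cutMatch-last : ∀ u v → endsOnFloor 0 u ≡ true → ballotFrom 0 v ≡ true →
    cutMatch u v ≡ match⁻ (u ++ true ∷ v)
  cutMatch-last u v on bv = cong 𝟙 (allEq-cut (length≡ups+downs u) (peaks-++-cut 0 u true v on bv)
    (cong suc (trans (proj₁ (depth-++ 0 u (true ∷ v) on))
                     (trans (cong (λ z → downs u + pred z) (ballot⇒depth≡0 v bv)) (+-identityʳ (downs u)))))
    (cong suc (downs-++ u (true ∷ v))))

  cutMatch-end : ∀ w → endsOnFloor 0 w ≡ true →
    𝟙 (allEq (2 * ups w + h) (suc (length w)) (0 + ups w + h) d (peaks w + 0) k) ≡ match⁻ w
  cutMatch-end w on = cong 𝟙 (allEq-cut (length≡ups+downs w) (sym (+-identityʳ (peaks w)))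
    (cong suc (trans (cong (λ x → depth x + ups w) (sym (++-identityʳ w)))
                     (trans (proj₁ (depth-++ 0 w [] on)) (+-identityʳ (downs w)))))
    (cong suc (sym (+-identityʳ (downs w)))))

  cutMatch-start : ∀ w → ballotFrom 0 w ≡ true →
    𝟙 (allEq (2 * 0 + h) 0 (downs w + 0 + h) d (0 + peaks w) k) ≡ match w
  cutMatch-start w bw = cong 𝟙 (allEq-cong forward backward)
    where
    depth≡0 : depth w ≡ 0
    depth≡0 = ballot⇒depth≡0 w bw
    downs+0+h : h ≡ 0 → downs w + 0 + h ≡ downs w
    downs+0+h h≡0 = trans (cong (_+_ (downs w + 0)) h≡0) (trans (+-identityʳ _) (+-identityʳ _))
    forward : h ≡ 0 → downs w + 0 + h ≡ d → 0 + peaks w ≡ k → (peaks w ≡ k) × (depth w ≡ h) × (downs w ≡ d)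
    forward h≡0 e₂ e₃ = e₃ , trans depth≡0 (sym h≡0) , trans (sym (downs+0+h h≡0)) e₂
    backward : peaks w ≡ k → depth w ≡ h → downs w ≡ d → (h ≡ 0) × (downs w + 0 + h ≡ d) × (0 + peaks w ≡ k)
    backward e₁ depth≡h e₃ = h≡0 , trans (downs+0+h h≡0) e₃ , e₁
      where h≡0 = trans (sym depth≡h) depth≡0

  ∑cutWeights : ∀ w →
    startWeight w + ∑cuts w (λ u _ v → middleWeight u v) + endWeight w ≡ match w + match⁻ w
  ∑cutWeights w = begin
    start + ∑cuts w middle + end                        ≡⟨ cong (λ z → start + z + end) split ⟩
    start + (∑cuts w descent + ∑cuts w ascent) + end    ≡⟨ regroup start (∑cuts w descent) _ end ⟩
    (start + ∑cuts w descent) + (∑cuts w ascent + end)  ≡⟨ cong₂ _+_ firstMin lastMin ⟩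
    match w + (match⁻ w + 0)                            ≡⟨ cong (_+_ (match w)) (+-identityʳ (match⁻ w)) ⟩
    match w + match⁻ w                                  ∎
    where
    open ≡-Reasoning
    start = startWeight w
    end   = endWeight w
    endMatch = 𝟙 (allEq (2 * ups w + h) (suc (length w)) (0 + ups w + h) d (peaks w + 0) k)
    middle descent ascent : List Bool → Bool → List Bool → ℕ
    middle  u _ v = middleWeight u v
    descent u c v = 𝟙 (not c ∧ endsOnFloor 0 u ∧ ballotFrom 0 v) * cutMatch u v
    ascent  u c v = 𝟙 (c ∧ endsOnFloor 0 u ∧ ballotFrom 0 v) * cutMatch u v
    split : ∑cuts w middle ≡ ∑cuts w descent + ∑cuts w ascent
    split = trans (∑cuts-cong w (λ u c v → trans (cong (_* cutMatch u v) (𝟙-split c _))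
                    (*-distribʳ-+ (cutMatch u v) (𝟙 (not c ∧ _)) (𝟙 (c ∧ _)))))
                  (∑cuts-+ w descent ascent)
    regroup : ∀ a b c e → a + (b + c) + e ≡ (a + b) + (c + e)
    regroup a b c e = trans (cong (_+ e) (sym (+-assoc a b c))) (+-assoc (a + b) c e)
    firstMin : start + ∑cuts w descent ≡ match w
    firstMin = first-minimum-cut 0 w _ cutMatch (match w) (cutMatch-start w)
      (λ u v e on bv → trans (cutMatch-first u v on bv) (cong match e))
    lastMin : ∑cuts w ascent + end ≡ match⁻ w + 0
    lastMin = trans (cong (λ b → ∑cuts w ascent + 𝟙 b * endMatch) (∧-identityʳ (endsOnFloor 0 w)))
      (last-minimum-cut 0 w endMatch cutMatch (match⁻ w) (cutMatch-end w)
        (λ u v e on bv → trans (cutMatch-last u v on bv) (cong match⁻ e)))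

upDownFrom : ℕ → List ℕ → List Bool
upDownFrom x []       = []
upDownFrom x (y ∷ ys) = (x <ᵇ y) ∷ upDownFrom y ys

upDown : List ℕ → List Bool
upDown []       = []
upDown (x ∷ xs) = upDownFrom x xs

-- Distinct adjacent entries are all that is needed of a permutation for its
-- statistics to be functions of its up-down word.
AdjDistinctFrom : ℕ → List ℕ → Set
AdjDistinctFrom x []       = ⊤
AdjDistinctFrom x (y ∷ ys) = (x ≢ y) × AdjDistinctFrom y ys

AdjDistinct : List ℕ → Set
AdjDistinct []       = ⊤
AdjDistinct (x ∷ xs) = AdjDistinctFrom x xs

length-upDownFrom : ∀ x xs → length (upDownFrom x xs) ≡ length xs
length-upDownFrom x []       = refl
length-upDownFrom x (y ∷ ys) = cong suc (length-upDownFrom y ys)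

des-upDownFrom : ∀ x xs → AdjDistinctFrom x xs → des (x ∷ xs) ≡ downs (upDownFrom x xs)
des-upDownFrom x []       _          = refl
des-upDownFrom x (y ∷ ys) (x≢y , ad) rewrite <ᵇ-flip x y x≢y with x <ᵇ y
... | true  = des-upDownFrom y ys ad
... | false = cong suc (des-upDownFrom y ys ad)

pk-upDownFrom : ∀ x xs → AdjDistinctFrom x xs → pk (x ∷ xs) ≡ peaks (upDownFrom x xs)
pk-upDownFrom x []           _                = refl
pk-upDownFrom x (y ∷ [])     _                = refl
pk-upDownFrom x (y ∷ z ∷ zs) (x≢y , y≢z , ad) =
  cong₂ _+_ (peak (x <ᵇ y) (z <ᵇ y) (y <ᵇ z) (<ᵇ-flip y z y≢z)) (pk-upDownFrom y (z ∷ zs) (y≢z , ad))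
  where
  peak : ∀ a b c → b ≡ not c → (if a ∧ b then 1 else 0) ≡ peakAt a (c ∷ upDownFrom z zs)
  peak true  b true  refl = refl
  peak true  b false refl = refl
  peak false b true  _    = refl
  peak false b false _    = refl

stepℤ : Bool → ℤ
stepℤ true  = + 1
stepℤ false = -[1+ 0 ]

heights : List ℕ → List ℤ
heights π = map hgt (prefixes π)

hgt-cons : ∀ a b σ → a ≢ b → hgt (a ∷ b ∷ σ) ≡ stepℤ (a <ᵇ b) ℤ.+ hgt (b ∷ σ)
hgt-cons a b σ a≢b rewrite <ᵇ-flip a b a≢b with a <ᵇ b
... | true  = ℤ.+-assoc (+ 1) (+ asc (b ∷ σ)) (ℤ.- (+ des (b ∷ σ)))
... | false = begin
  + A ℤ.+ ℤ.- + suc D              ≡⟨ cong (ℤ._+_ (+ A)) (-[1+D]≡-1-D D) ⟩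
  + A ℤ.+ (-[1+ 0 ] ℤ.+ ℤ.- + D)   ≡⟨ sym (ℤ.+-assoc (+ A) -[1+ 0 ] (ℤ.- + D)) ⟩
  + A ℤ.+ -[1+ 0 ] ℤ.+ ℤ.- + D     ≡⟨ cong (ℤ._+ ℤ.- + D) (ℤ.+-comm (+ A) -[1+ 0 ]) ⟩
  -[1+ 0 ] ℤ.+ + A ℤ.+ ℤ.- + D     ≡⟨ ℤ.+-assoc -[1+ 0 ] (+ A) (ℤ.- + D) ⟩
  -[1+ 0 ] ℤ.+ (+ A ℤ.+ ℤ.- + D)   ∎
  where
  open ≡-Reasoning
  A = asc (b ∷ σ)
  D = des (b ∷ σ)
  -[1+D]≡-1-D : ∀ D → ℤ.- + suc D ≡ -[1+ 0 ] ℤ.+ ℤ.- + D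
  -[1+D]≡-1-D zero    = refl
  -[1+D]≡-1-D (suc D) = refl

heights-cons : ∀ a b xs → a ≢ b →
  heights (a ∷ b ∷ xs) ≡ + 0 ∷ map (ℤ._+_ (stepℤ (a <ᵇ b))) (heights (b ∷ xs))
heights-cons a b xs a≢b = cong (+ 0 ∷_) (cong₂ _∷_ (hgt-cons a b [] a≢b) (shifted (prefixes xs)))
  where
  shifted : ∀ P →
    map hgt (map (a ∷_) (map (b ∷_) P)) ≡ map (ℤ._+_ (stepℤ (a <ᵇ b))) (map hgt (map (b ∷_) P))
  shifted []      = refl
  shifted (σ ∷ P) = cong₂ _∷_ (hgt-cons a b σ a≢b) (shifted P)

minimum⁺-shift : ∀ s a l → minimum⁺ (s ℤ.+ a) (map (ℤ._+_ s) l) ≡ s ℤ.+ minimum⁺ a l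
minimum⁺-shift s a []       = refl
minimum⁺-shift s a (y ∷ ys) =
  trans (cong ((s ℤ.+ a) ⊓_) (minimum⁺-shift s y ys))
        (sym (ℤ.mono-<-distrib-⊓ (ℤ._+_ s) (ℤ.+-monoʳ-< s) a (minimum⁺ y ys)))

minHeight : List ℤ → ℤ
minHeight []       = + 0
minHeight (y ∷ ys) = minimum⁺ y ys

dp-upDownFrom : ∀ x xs → AdjDistinctFrom x xs → dp (x ∷ xs) ≡ + depth (upDownFrom x xs)
dp-upDownFrom x []       _          = refl
dp-upDownFrom x (y ∷ ys) (x≢y , ad) = begin
  dp (x ∷ y ∷ ys)
    ≡⟨⟩
  ℤ.- minHeight (heights (x ∷ y ∷ ys))
    ≡⟨ cong (λ H → ℤ.- minHeight H) (heights-cons x y ys x≢y) ⟩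
  ℤ.- (+ 0 ⊓ minimum⁺ (s ℤ.+ + 0) (map (ℤ._+_ s) rest))
    ≡⟨ cong (λ z → ℤ.- (+ 0 ⊓ z)) (minimum⁺-shift s (+ 0) rest) ⟩
  ℤ.- (+ 0 ⊓ (s ℤ.+ minimum⁺ (+ 0) rest))
    ≡⟨ cong (λ z → ℤ.- (+ 0 ⊓ (s ℤ.+ z))) min-rest ⟩
  ℤ.- (+ 0 ⊓ (s ℤ.+ ℤ.- + depth (upDownFrom y ys)))
    ≡⟨ step (x <ᵇ y) (upDownFrom y ys) ⟩
  + depth (upDownFrom x (y ∷ ys)) ∎
  where
  open ≡-Reasoning
  s = stepℤ (x <ᵇ y)
  rest = map hgt (map (y ∷_) (prefixes ys))
  min-rest : minimum⁺ (+ 0) rest ≡ ℤ.- + depth (upDownFrom y ys)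
  min-rest = trans (sym (ℤ.neg-involutive _)) (cong ℤ.-_ (dp-upDownFrom y ys ad))
  step : ∀ c w → ℤ.- (+ 0 ⊓ (stepℤ c ℤ.+ ℤ.- + depth w)) ≡ + depth (c ∷ w)
  step true  w with depth w
  ... | zero        = refl
  ... | suc zero    = refl
  ... | suc (suc D) = refl
  step false w with depth w
  ... | zero        = refl
  ... | suc D       = refl

allNonNeg : List ℤ → Bool
allNonNeg []       = true
allNonNeg (y ∷ ys) = does (+ 0 ℤ.≤? y) ∧ allNonNeg ys

allNonNeg-unique : (g : List ℤ → Bool) → g [] ≡ true →
  (∀ y ys → g (y ∷ ys) ≡ (does (+ 0 ℤ.≤? y) ∧ g ys)) → ∀ L → g L ≡ allNonNeg L
allNonNeg-unique g g[] g∷ []       = g[]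
allNonNeg-unique g g[] g∷ (y ∷ ys) =
  trans (g∷ y ys) (cong (does (+ 0 ℤ.≤? y) ∧_) (allNonNeg-unique g g[] g∷ ys))

-- Defs.isBallot runs a local test on the heights, which cannot be named: the
-- meta test is solved by unification against the unfolded definition.
isBallot≡allNonNeg : ∀ π → isBallot π ≡ allNonNeg (heights π)
isBallot≡allNonNeg π =
  trans (isBallot-as-test (heights π) refl) (allNonNeg-unique test refl (λ _ _ → refl) (heights π))
  where
  test : List ℤ → Bool
  test = _
  isBallot-as-test : ∀ L → heights π ≡ L → isBallot π ≡ test L
  isBallot-as-test L e with heights π | e
  ... | .L | refl = refl

allNonNeg-shift : ∀ t x xs → AdjDistinctFrom x xs →
  allNonNeg (map (ℤ._+_ (+ t)) (heights (x ∷ xs))) ≡ ballotFrom t (upDownFrom x xs)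
allNonNeg-shift t x []       _          = refl
allNonNeg-shift t x (y ∷ ys) (x≢y , ad) =
  trans (cong (λ H → allNonNeg (map (ℤ._+_ (+ t)) H)) (heights-cons x y ys x≢y)) (step t (x <ᵇ y))
  where
  H = heights (y ∷ ys)
  shift-shift : ∀ a b c → a ℤ.+ b ≡ c → map (ℤ._+_ a) (map (ℤ._+_ b) H) ≡ map (ℤ._+_ c) H
  shift-shift a b c e =
    trans (sym (map-∘ H)) (map-cong (λ z → trans (sym (ℤ.+-assoc a b z)) (cong (ℤ._+ z) e)) H)
  step : ∀ t c → allNonNeg (map (ℤ._+_ (+ t)) (+ 0 ∷ map (ℤ._+_ (stepℤ c)) H))
                 ≡ ballotFrom t (c ∷ upDownFrom y ys)
  step t       true  = trans (cong allNonNeg (shift-shift (+ t) (+ 1) (+ suc t) (cong +_ (+-comm t 1))))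
                             (allNonNeg-shift (suc t) y ys ad)
  step zero    false = refl
  step (suc t) false = trans (cong allNonNeg (shift-shift (+ suc t) -[1+ 0 ] (+ t) (1+t-1 t)))
                             (allNonNeg-shift t y ys ad)
    where
    1+t-1 : ∀ t → + suc t ℤ.+ -[1+ 0 ] ≡ + t
    1+t-1 zero    = refl
    1+t-1 (suc t) = refl

des-upDown : ∀ π → AdjDistinct π → des π ≡ downs (upDown π)
des-upDown []       _  = refl
des-upDown (x ∷ xs) ad = des-upDownFrom x xs ad

pk-upDown : ∀ π → AdjDistinct π → pk π ≡ peaks (upDown π)
pk-upDown []       _  = refl
pk-upDown (x ∷ xs) ad = pk-upDownFrom x xs ad

dp-upDown : ∀ π → AdjDistinct π → dp π ≡ + depth (upDown π)
dp-upDown []       _  = refl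
dp-upDown (x ∷ xs) ad = dp-upDownFrom x xs ad

isBallot-upDown : ∀ π → AdjDistinct π → isBallot π ≡ ballotFrom 0 (upDown π)
isBallot-upDown []       _  = refl
isBallot-upDown (x ∷ xs) ad = begin
  isBallot (x ∷ xs)                                 ≡⟨ isBallot≡allNonNeg (x ∷ xs) ⟩
  allNonNeg (heights (x ∷ xs))                      ≡⟨ cong allNonNeg (sym (map-shift-0 (heights (x ∷ xs)))) ⟩
  allNonNeg (map (ℤ._+_ (+ 0)) (heights (x ∷ xs)))  ≡⟨ allNonNeg-shift 0 x xs ad ⟩
  ballotFrom 0 (upDownFrom x xs)                    ∎
  where
  open ≡-Reasoning
  map-shift-0 : ∀ L → map (ℤ._+_ (+ 0)) L ≡ L
  map-shift-0 L = trans (map-cong ℤ.+-identityˡ L) (map-id L)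

-- Reversal

mirror : List Bool → List Bool
mirror u = reverse (map not u)

mirror-∷ : ∀ c u → mirror (c ∷ u) ≡ mirror u ∷ʳ not c
mirror-∷ c u = unfold-reverse (not c) (map not u)

heightAfter : ℕ → List Bool → ℕ
heightAfter s       []          = s
heightAfter s       (true ∷ w)  = heightAfter (suc s) w
heightAfter zero    (false ∷ w) = zero
heightAfter (suc s) (false ∷ w) = heightAfter s w

ballotFrom-++ : ∀ s u v → ballotFrom s (u ++ v) ≡ (ballotFrom s u ∧ ballotFrom (heightAfter s u) v)
ballotFrom-++ s       []          v = refl
ballotFrom-++ s       (true ∷ u)  v = ballotFrom-++ (suc s) u v
ballotFrom-++ zero    (false ∷ u) v = refl
ballotFrom-++ (suc s) (false ∷ u) v = ballotFrom-++ s u v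

heightAfter-++ : ∀ s u v → ballotFrom s u ≡ true →
  heightAfter s (u ++ v) ≡ heightAfter (heightAfter s u) v
heightAfter-++ s       []          v _  = refl
heightAfter-++ s       (true ∷ u)  v bu = heightAfter-++ (suc s) u v bu
heightAfter-++ (suc s) (false ∷ u) v bu = heightAfter-++ s u v bu

endsOnFloor-mirror : ∀ s u →
  endsOnFloor s u ≡ (ballotFrom 0 (mirror u) ∧ (s ≤ᵇ heightAfter 0 (mirror u)))
endsOnFloor-mirror zero    []      = refl
endsOnFloor-mirror (suc s) []      = refl
endsOnFloor-mirror s       (c ∷ u) =
  trans (endsOnFloor-mirror (floorStep s c) u)
        (trans (last-step s c (ballotFrom 0 (mirror u)) (heightAfter 0 (mirror u))) append)
  where
  ≤ᵇ-suc : ∀ s ℓ → (s ≤ᵇ ℓ) ≡ (suc s ≤ᵇ suc ℓ)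
  ≤ᵇ-suc zero    ℓ = refl
  ≤ᵇ-suc (suc s) ℓ = refl
  last-step : ∀ s c a ℓ →
    (a ∧ (floorStep s c ≤ᵇ ℓ)) ≡ ((a ∧ ballotFrom ℓ (not c ∷ [])) ∧ (s ≤ᵇ heightAfter ℓ (not c ∷ [])))
  last-step s       c     false ℓ       = refl
  last-step s       true  true  zero    = refl
  last-step s       true  true  (suc ℓ) = sym (≤ᵇ-suc s ℓ)
  last-step zero    false true  ℓ       = refl
  last-step (suc s) false true  ℓ       = ≤ᵇ-suc s ℓ
  append : ((ballotFrom 0 (mirror u) ∧ ballotFrom (heightAfter 0 (mirror u)) (not c ∷ []))
             ∧ (s ≤ᵇ heightAfter (heightAfter 0 (mirror u)) (not c ∷ [])))
           ≡ (ballotFrom 0 (mirror (c ∷ u)) ∧ (s ≤ᵇ heightAfter 0 (mirror (c ∷ u))))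
  append rewrite mirror-∷ c u | ballotFrom-++ 0 (mirror u) (not c ∷ []) with ballotFrom 0 (mirror u) in bu
  ... | false = refl
  ... | true rewrite heightAfter-++ 0 (mirror u) (not c ∷ []) bu = refl

endsOnFloor≡ballot-mirror : ∀ u → endsOnFloor 0 u ≡ ballotFrom 0 (mirror u)
endsOnFloor≡ballot-mirror u = trans (endsOnFloor-mirror 0 u) (∧-identityʳ _)

downs-mirror : ∀ u → downs (mirror u) ≡ ups u
downs-mirror u = trans (downs-reverse (map not u)) (downs-map-not u)
  where
  downs-reverse : ∀ w → downs (reverse w) ≡ downs w
  downs-reverse []      = refl
  downs-reverse (c ∷ w) = begin
    downs (reverse (c ∷ w))             ≡⟨ cong downs (unfold-reverse c w) ⟩
    downs (reverse w ++ c ∷ [])         ≡⟨ downs-++ (reverse w) (c ∷ []) ⟩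
    downs (reverse w) + downs (c ∷ [])  ≡⟨ cong (_+ downs (c ∷ [])) (downs-reverse w) ⟩
    downs w + downs (c ∷ [])            ≡⟨ last c ⟩
    downs (c ∷ w)                       ∎
    where
    open ≡-Reasoning
    last : ∀ c → downs w + downs (c ∷ []) ≡ downs (c ∷ w)
    last true  = +-identityʳ _
    last false = +-comm (downs w) 1
  downs-map-not : ∀ u → downs (map not u) ≡ ups u
  downs-map-not []          = refl
  downs-map-not (true ∷ u)  = cong suc (downs-map-not u)
  downs-map-not (false ∷ u) = downs-map-not u

peakAtEnd : List Bool → Bool → ℕ
peakAtEnd []           c = 0
peakAtEnd (b ∷ [])     c = peakAt b (c ∷ [])
peakAtEnd (b ∷ b′ ∷ w) c = peakAtEnd (b′ ∷ w) c

peaks-∷ʳ : ∀ w c → peaks (w ∷ʳ c) ≡ peaks w + peakAtEnd w c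
peaks-∷ʳ []           c = refl
peaks-∷ʳ (b ∷ [])     c = +-comm (peakAt b (c ∷ [])) 0
peaks-∷ʳ (b ∷ b′ ∷ w) c =
  trans (cong₂ _+_ (peakAt-cong b b′ (w ∷ʳ c) w) (peaks-∷ʳ (b′ ∷ w) c))
        (sym (+-assoc (peakAt b (b′ ∷ w)) _ _))

peakAtEnd-∷ʳ : ∀ w b c → peakAtEnd (w ∷ʳ b) c ≡ peakAt b (c ∷ [])
peakAtEnd-∷ʳ []           b c = refl
peakAtEnd-∷ʳ (a ∷ [])     b c = refl
peakAtEnd-∷ʳ (a ∷ a′ ∷ w) b c = peakAtEnd-∷ʳ (a′ ∷ w) b c

peaks-mirror : ∀ u → peaks (mirror u) ≡ peaks u
peaks-mirror []      = refl
peaks-mirror (c ∷ u) = begin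
  peaks (mirror (c ∷ u))                           ≡⟨ cong peaks (mirror-∷ c u) ⟩
  peaks (mirror u ∷ʳ not c)                        ≡⟨ peaks-∷ʳ (mirror u) (not c) ⟩
  peaks (mirror u) + peakAtEnd (mirror u) (not c)  ≡⟨ cong₂ _+_ (peaks-mirror u) (first-peak u) ⟩
  peaks u + peakAt c u                             ≡⟨ +-comm (peaks u) (peakAt c u) ⟩
  peaks (c ∷ u)                                    ∎
  where
  open ≡-Reasoning
  first-peak : ∀ u → peakAtEnd (mirror u) (not c) ≡ peakAt c u
  first-peak []      = refl
  first-peak (b ∷ u) =
    trans (cong (λ w → peakAtEnd w (not c)) (mirror-∷ b u))
          (trans (peakAtEnd-∷ʳ (mirror u) (not b) (not c)) (flipped c b))
    where
    flipped : ∀ c b → peakAt (not b) (not c ∷ []) ≡ peakAt c (b ∷ u)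
    flipped true  true  = refl
    flipped true  false = refl
    flipped false true  = refl
    flipped false false = refl

reverse-∷-∷ : ∀ (x y : ℕ) α → reverse (x ∷ y ∷ α) ≡ reverse α ++ y ∷ x ∷ []
reverse-∷-∷ x y α = trans (unfold-reverse x (y ∷ α))
  (trans (cong (_∷ʳ x) (unfold-reverse y α)) (++-assoc (reverse α) (y ∷ []) (x ∷ [])))

upDown-∷ʳ-∷ʳ : ∀ zs y z → upDown (zs ++ y ∷ z ∷ []) ≡ upDown (zs ++ y ∷ []) ∷ʳ (y <ᵇ z)
upDown-∷ʳ-∷ʳ []       y z = refl
upDown-∷ʳ-∷ʳ (w ∷ zs) y z = from w zs
  where
  from : ∀ x zs → upDownFrom x (zs ++ y ∷ z ∷ []) ≡ upDownFrom x (zs ++ y ∷ []) ∷ʳ (y <ᵇ z)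
  from x []       = refl
  from x (w ∷ zs) = cong ((x <ᵇ w) ∷_) (from w zs)

AdjDistinct-∷ʳ-∷ʳ : ∀ zs y z → AdjDistinct (zs ++ y ∷ []) → y ≢ z → AdjDistinct (zs ++ y ∷ z ∷ [])
AdjDistinct-∷ʳ-∷ʳ []       y z _  y≢z = y≢z , tt
AdjDistinct-∷ʳ-∷ʳ (w ∷ zs) y z ad y≢z = from w zs ad
  where
  from : ∀ x zs → AdjDistinctFrom x (zs ++ y ∷ []) → AdjDistinctFrom x (zs ++ y ∷ z ∷ [])
  from x []       (x≢y , _)  = x≢y , y≢z , tt
  from x (v ∷ zs) (x≢v , ad) = x≢v , from v zs ad

AdjDistinct-reverse : ∀ α → AdjDistinct α → AdjDistinct (reverse α)
AdjDistinct-reverse []           _          = tt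
AdjDistinct-reverse (x ∷ [])     _          = tt
AdjDistinct-reverse (x ∷ y ∷ α) (x≢y , ad) =
  subst AdjDistinct (sym (reverse-∷-∷ x y α))
    (AdjDistinct-∷ʳ-∷ʳ (reverse α) y x
      (subst AdjDistinct (unfold-reverse y α) (AdjDistinct-reverse (y ∷ α) ad)) (λ y≡x → x≢y (sym y≡x)))

upDown-reverse : ∀ α → AdjDistinct α → upDown (reverse α) ≡ mirror (upDown α)
upDown-reverse []           _          = refl
upDown-reverse (x ∷ [])     _          = refl
upDown-reverse (x ∷ y ∷ α) (x≢y , ad) = begin
  upDown (reverse (x ∷ y ∷ α))
    ≡⟨ cong upDown (reverse-∷-∷ x y α) ⟩
  upDown (reverse α ++ y ∷ x ∷ [])
    ≡⟨ upDown-∷ʳ-∷ʳ (reverse α) y x ⟩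
  upDown (reverse α ++ y ∷ []) ∷ʳ (y <ᵇ x)
    ≡⟨ cong₂ (λ a b → upDown a ∷ʳ b) (sym (unfold-reverse y α)) (<ᵇ-flip x y x≢y) ⟩
  upDown (reverse (y ∷ α)) ∷ʳ not (x <ᵇ y)
    ≡⟨ cong (_∷ʳ not (x <ᵇ y)) (upDown-reverse (y ∷ α) ad) ⟩
  mirror (upDown (y ∷ α)) ∷ʳ not (x <ᵇ y)
    ≡⟨ sym (mirror-∷ (x <ᵇ y) (upDown (y ∷ α))) ⟩
  mirror (upDown (x ∷ y ∷ α)) ∎
  where open ≡-Reasoning

isBallot-reverse : ∀ α → AdjDistinct α → isBallot (reverse α) ≡ endsOnFloor 0 (upDown α)
isBallot-reverse α ad = begin
  isBallot (reverse α)                ≡⟨ isBallot-upDown (reverse α) (AdjDistinct-reverse α ad) ⟩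
  ballotFrom 0 (upDown (reverse α))   ≡⟨ cong (ballotFrom 0) (upDown-reverse α ad) ⟩
  ballotFrom 0 (mirror (upDown α))    ≡⟨ sym (endsOnFloor≡ballot-mirror (upDown α)) ⟩
  endsOnFloor 0 (upDown α)            ∎
  where open ≡-Reasoning

des-reverse : ∀ α → AdjDistinct α → des (reverse α) ≡ ups (upDown α)
des-reverse α ad = trans (des-upDown (reverse α) (AdjDistinct-reverse α ad))
  (trans (cong downs (upDown-reverse α ad)) (downs-mirror (upDown α)))

pk-reverse : ∀ α → AdjDistinct α → pk (reverse α) ≡ peaks (upDown α)
pk-reverse α ad = trans (pk-upDown (reverse α) (AdjDistinct-reverse α ad))
  (trans (cong peaks (upDown-reverse α ad)) (peaks-mirror (upDown α)))

-- leftOK and rightOK are the conditions of the (i, j) term on the right on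
-- its two ballot permutations σ and τ.
module Terms (h d k : ℕ) where
  open CutWeight h d k

  leftOK rightOK : ℕ → ℕ → List ℕ → Bool
  leftOK  i j σ = isBallot σ ∧ eqℤ (+ pk σ) (+ j) ∧ eqℤ (+ des σ) (+ i)
  rightOK i j τ = isBallot τ ∧ eqℤ (+ pk τ) (+ k - + j) ∧ eqℤ (+ des τ) (+ d - + i - + h)

  pairOK : ℕ → ℕ → List ℕ → List ℕ → ℕ
  pairOK i j σ τ = 𝟙 (leftOK i j σ) * 𝟙 (rightOK i j τ)

  splitTerm : ℕ → ℕ → ℕ → List ℕ → ℕ
  splitTerm n i j π = 𝟙 (2 * i + h ≤ᵇ n) * pairOK i j (reverse (take (2 * i + h) π)) (drop (2 * i + h) π)

  shapeOK : ℕ → List ℕ → List ℕ → ℕ → ℕ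
  shapeOK m σ τ i = 𝟙 (2 * i + h ≡ᵇ m) * 𝟙 (isBallot σ) * 𝟙 (isBallot τ) * 𝟙 (des τ + i + h ≡ᵇ d)

  peaksOK : List ℕ → List ℕ → ℕ → ℕ
  peaksOK σ τ j = 𝟙 (pk σ ≡ᵇ j) * 𝟙 (pk τ + j ≡ᵇ k)

  pairOK-factor : ∀ m σ τ i j →
    𝟙 (2 * i + h ≡ᵇ m) * pairOK i j σ τ ≡ 𝟙 (des σ ≡ᵇ i) * (shapeOK m σ τ i * peaksOK σ τ j)
  pairOK-factor m σ τ i j = begin
    M * (𝟙 (isBallot σ ∧ (pk σ ≡ᵇ j) ∧ (des σ ≡ᵇ i))
         * 𝟙 (isBallot τ ∧ eqℤ (+ pk τ) (+ k - + j) ∧ eqℤ (+ des τ) (+ d - + i - + h)))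
      ≡⟨ cong (_*_ M) (cong₂ _*_
           (trans (𝟙-∧ (isBallot σ) _) (cong (_*_ Bσ) (𝟙-∧ (pk σ ≡ᵇ j) (des σ ≡ᵇ i))))
           (trans (𝟙-∧ (isBallot τ) _) (cong (_*_ Bτ)
             (trans (𝟙-∧ (eqℤ (+ pk τ) (+ k - + j)) _)
                    (cong₂ _*_ (cong 𝟙 (eqℤ-+-∸ (pk τ) k j)) (cong 𝟙 (eqℤ-+-∸-∸ (des τ) d i h))))))) ⟩
    M * ((Bσ * (Pσ * Dσ)) * (Bτ * (Pτ * Dτ)))
      ≡⟨ solve 7 (λ M Bσ Pσ Dσ Bτ Pτ Dτ →
            M :* ((Bσ :* (Pσ :* Dσ)) :* (Bτ :* (Pτ :* Dτ))) := Dσ :* ((M :* Bσ :* Bτ :* Dτ) :* (Pσ :* Pτ)))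
           refl M Bσ Pσ Dσ Bτ Pτ Dτ ⟩
    Dσ * ((M * Bσ * Bτ * Dτ) * (Pσ * Pτ)) ∎
    where
    open ≡-Reasoning
    open +-*-Solver using (solve; _:*_; _:=_)
    M  = 𝟙 (2 * i + h ≡ᵇ m)
    Bσ = 𝟙 (isBallot σ)
    Bτ = 𝟙 (isBallot τ)
    Pσ = 𝟙 (pk σ ≡ᵇ j)
    Dσ = 𝟙 (des σ ≡ᵇ i)
    Pτ = 𝟙 (pk τ + j ≡ᵇ k)
    Dτ = 𝟙 (des τ + i + h ≡ᵇ d)

  ∑pairOK≡cutWeight : ∀ n m σ τ → des σ ≤ n →
    ∑< (suc n) (λ i → ∑< (suc k) (λ j → 𝟙 (2 * i + h ≡ᵇ m) * pairOK i j σ τ))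
      ≡ cutWeight (isBallot σ) (des σ) (pk σ) (isBallot τ) (des τ) (pk τ) m
  ∑pairOK≡cutWeight n m σ τ des≤n = begin
    ∑< (suc n) (λ i → ∑< (suc k) (λ j → 𝟙 (2 * i + h ≡ᵇ m) * pairOK i j σ τ))
      ≡⟨ ∑<-cong (suc n) (λ i → ∑<-cong (suc k) (pairOK-factor m σ τ i)) ⟩
    ∑< (suc n) (λ i → ∑< (suc k) (λ j → 𝟙 (des σ ≡ᵇ i) * (Q i * peaksOK σ τ j)))
      ≡⟨ ∑<-cong (suc n) (λ i → trans (∑<-*ˡ (suc k) (𝟙 (des σ ≡ᵇ i)) (λ j → Q i * peaksOK σ τ j))
           (cong (_*_ (𝟙 (des σ ≡ᵇ i))) (trans (∑<-*ˡ (suc k) (Q i) (peaksOK σ τ))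
             (cong (_*_ (Q i)) (∑<-pair-indicator (pk σ) (pk τ) k))))) ⟩
    ∑< (suc n) (λ i → 𝟙 (des σ ≡ᵇ i) * (Q i * W))
      ≡⟨ ∑<-indicator (suc n) (des σ) (λ i → Q i * W) ⟩
    𝟙 (des σ <ᵇ suc n) * (Q (des σ) * W)
      ≡⟨ cong (λ b → 𝟙 b * (Q (des σ) * W)) (T⇒≡true (<⇒<ᵇ (s≤s des≤n))) ⟩
    Q (des σ) * W + 0
      ≡⟨ +-identityʳ _ ⟩
    Q (des σ) * W
      ≡⟨ regroup ⟩
    cutWeight (isBallot σ) (des σ) (pk σ) (isBallot τ) (des τ) (pk τ) m ∎
    where
    open ≡-Reasoning
    open +-*-Solver using (solve; _:*_; _:=_)
    Q : ℕ → ℕ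
    Q = shapeOK m σ τ
    W = 𝟙 (pk σ + pk τ ≡ᵇ k)
    M  = 𝟙 (2 * des σ + h ≡ᵇ m)
    D  = 𝟙 (des τ + des σ + h ≡ᵇ d)
    regroup : Q (des σ) * W ≡ cutWeight (isBallot σ) (des σ) (pk σ) (isBallot τ) (des τ) (pk τ) m
    regroup = trans
      (solve 5 (λ M Bσ Bτ D P → (M :* Bσ :* Bτ :* D) :* P := (Bσ :* Bτ) :* (M :* (D :* P))) refl
        M (𝟙 (isBallot σ)) (𝟙 (isBallot τ)) D W)
      (cong₂ _*_ (sym (𝟙-∧ (isBallot σ) (isBallot τ)))
        (sym (trans (𝟙-∧ (2 * des σ + h ≡ᵇ m) _) (cong (_*_ M) (𝟙-∧ (des τ + des σ + h ≡ᵇ d) _)))))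

∑splits : List ℕ → (List ℕ → List ℕ → ℕ) → ℕ
∑splits []       F = 0
∑splits (y ∷ ys) F = F [] (y ∷ ys) + ∑splits ys (λ a b → F (y ∷ a) b)

∑<-take-drop : ∀ ys (F : List ℕ → List ℕ → ℕ) →
  ∑< (suc (length ys)) (λ m → F (take m ys) (drop m ys)) ≡ ∑splits ys F + F ys []
∑<-take-drop []       F = +-comm (F [] []) 0
∑<-take-drop (y ∷ ys) F = trans (cong (_+_ (F [] (y ∷ ys))) (∑<-take-drop ys (λ a b → F (y ∷ a) b)))
                                (sym (+-assoc (F [] (y ∷ ys)) _ _))

∑splits-cong : ∀ x ys {F G : List ℕ → List ℕ → ℕ} → AdjDistinctFrom x ys →
  (∀ a b → AdjDistinctFrom x a → AdjDistinct b → F a b ≡ G a b) → ∑splits ys F ≡ ∑splits ys G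
∑splits-cong x []       _          e = refl
∑splits-cong x (y ∷ ys) (x≢y , ad) e =
  cong₂ _+_ (e [] (y ∷ ys) tt ad) (∑splits-cong y ys ad (λ a b ada adb → e (y ∷ a) b (x≢y , ada) adb))

∑splits-upDown : ∀ x ys (G : List Bool → List Bool → ℕ) →
  ∑splits ys (λ a b → G (upDownFrom x a) (upDown b)) ≡ ∑cuts (upDownFrom x ys) (λ u c v → G u v)
∑splits-upDown x []       G = refl
∑splits-upDown x (y ∷ ys) G =
  cong (_+_ (G [] (upDownFrom y ys))) (∑splits-upDown y ys (λ u v → G ((x <ᵇ y) ∷ u) v))

des≤length : ∀ π → des π ≤ length π
des≤length []          = z≤n
des≤length (a ∷ [])    = z≤n
des≤length (a ∷ b ∷ π) = +-mono-≤ (bit (b <ᵇ a)) (des≤length (b ∷ π))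
  where
  bit : ∀ c → (if c then 1 else 0) ≤ 1
  bit true  = s≤s z≤n
  bit false = z≤n

module PerPermutation (h d k : ℕ) where
  open CutWeight h d k

  cutWeightOf : List ℕ → List ℕ → ℕ
  cutWeightOf α β =
    cutWeight (isBallot (reverse α)) (des (reverse α)) (pk (reverse α)) (isBallot β) (des β) (pk β) (length α)

  counted counted⁻ : List ℕ → Bool
  counted  π = eqℤ (+ pk π) (+ k) ∧ eqℤ (dp π) (+ h) ∧ eqℤ (+ des π) (+ d)
  counted⁻ π = eqℤ (+ pk π) (+ k) ∧ eqℤ (dp π) (+ h - + 1) ∧ eqℤ (+ des π) (+ d - + 1)

  cutWeightOf-start : ∀ π → AdjDistinct π → cutWeightOf [] π ≡ startWeight (upDown π)
  cutWeightOf-start π ad rewrite isBallot-upDown π ad | des-upDown π ad | pk-upDown π ad = refl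

  cutWeightOf-middle : ∀ x a b → AdjDistinctFrom x a → AdjDistinct b →
    cutWeightOf (x ∷ a) b ≡ middleWeight (upDownFrom x a) (upDown b)
  cutWeightOf-middle x a b ada adb
    rewrite isBallot-reverse (x ∷ a) ada | des-reverse (x ∷ a) ada | pk-reverse (x ∷ a) ada
          | isBallot-upDown b adb | des-upDown b adb | pk-upDown b adb | length-upDownFrom x a = refl

  cutWeightOf-end : ∀ x xs → AdjDistinctFrom x xs → cutWeightOf (x ∷ xs) [] ≡ endWeight (upDownFrom x xs)
  cutWeightOf-end x xs ad
    rewrite isBallot-reverse (x ∷ xs) ad | des-reverse (x ∷ xs) ad | pk-reverse (x ∷ xs) ad
          | length-upDownFrom x xs = refl

  match≡counted : ∀ π → AdjDistinct π → match (upDown π) ≡ 𝟙 (counted π)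
  match≡counted π ad rewrite pk-upDown π ad | dp-upDown π ad | des-upDown π ad = refl

  match⁻≡counted⁻ : ∀ π → AdjDistinct π → match⁻ (upDown π) ≡ 𝟙 (counted⁻ π)
  match⁻≡counted⁻ π ad
    rewrite pk-upDown π ad | dp-upDown π ad | des-upDown π ad
          | eqℤ-∸ (+ depth (upDown π)) 1 (+ h) | eqℤ-∸ (+ downs (upDown π)) 1 (+ d)
          | +-comm (depth (upDown π)) 1 | +-comm (downs (upDown π)) 1 = refl

  ∑cutWeightOf-∷ : ∀ x xs → AdjDistinctFrom x xs →
    ∑< (suc (length (x ∷ xs))) (λ m → cutWeightOf (take m (x ∷ xs)) (drop m (x ∷ xs)))
      ≡ 𝟙 (counted (x ∷ xs)) + 𝟙 (counted⁻ (x ∷ xs))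
  ∑cutWeightOf-∷ x xs ad = begin
    cutWeightOf [] (x ∷ xs) + ∑< (suc (length xs)) (λ m → cutWeightOf (x ∷ take m xs) (drop m xs))
      ≡⟨ cong (_+_ (cutWeightOf [] (x ∷ xs))) (∑<-take-drop xs (λ a b → cutWeightOf (x ∷ a) b)) ⟩
    cutWeightOf [] (x ∷ xs) + (∑splits xs (λ a b → cutWeightOf (x ∷ a) b) + cutWeightOf (x ∷ xs) [])
      ≡⟨ sym (+-assoc (cutWeightOf [] (x ∷ xs)) _ _) ⟩
    cutWeightOf [] (x ∷ xs) + ∑splits xs (λ a b → cutWeightOf (x ∷ a) b) + cutWeightOf (x ∷ xs) []
      ≡⟨ cong₂ _+_ (cong₂ _+_ (cutWeightOf-start (x ∷ xs) ad)
                              (trans (∑splits-cong x xs ad (cutWeightOf-middle x)) (∑splits-upDown x xs middleWeight)))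
                   (cutWeightOf-end x xs ad) ⟩
    startWeight w + ∑cuts w (λ u _ v → middleWeight u v) + endWeight w
      ≡⟨ ∑cutWeights w ⟩
    match w + match⁻ w
      ≡⟨ cong₂ _+_ (match≡counted (x ∷ xs) ad) (match⁻≡counted⁻ (x ∷ xs) ad) ⟩
    𝟙 (counted (x ∷ xs)) + 𝟙 (counted⁻ (x ∷ xs)) ∎
    where
    open ≡-Reasoning
    w = upDownFrom x xs

  -- The empty permutation contributes to the left-hand side for (0, 0, 0)
  -- and, through its second term, for (0, 1, 1), but its only cut is
  -- admissible just for (0, 0, 0).
  cutWeightOf-[] : ¬ (k ≡ 0 × h ≡ 1 × d ≡ 1) → cutWeightOf [] [] + 0 ≡ 𝟙 (counted []) + 𝟙 (counted⁻ [])
  cutWeightOf-[] excluded rewrite eqℤ-∸ (+ 0) 1 (+ h) | eqℤ-∸ (+ 0) 1 (+ d) = by-cases h d k excluded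
    where
    by-cases : ∀ h d k → ¬ (k ≡ 0 × h ≡ 1 × d ≡ 1) →
      CutWeight.cutWeight h d k true 0 0 true 0 0 0 + 0
        ≡ 𝟙 ((0 ≡ᵇ k) ∧ (0 ≡ᵇ h) ∧ (0 ≡ᵇ d)) + 𝟙 ((0 ≡ᵇ k) ∧ (1 ≡ᵇ h) ∧ (1 ≡ᵇ d))
    by-cases zero             zero          zero    _  = refl
    by-cases zero             zero          (suc k) _  = refl
    by-cases zero             (suc d)       zero    _  = refl
    by-cases zero             (suc d)       (suc k) _  = refl
    by-cases (suc zero)       d             (suc k) _  = refl
    by-cases (suc zero)       zero          zero    _  = refl
    by-cases (suc zero)       (suc zero)    zero    ex = ⊥-elim (ex (refl , refl , refl))
    by-cases (suc zero)       (suc (suc d)) zero    _  = refl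
    by-cases (suc (suc h))    d             zero    _  = refl
    by-cases (suc (suc h))    d             (suc k) _  = refl

  open Terms h d k

  ∑splitTerm≡counted : ∀ n π → AdjDistinct π → length π ≡ n → ¬ (n ≡ 0 × k ≡ 0 × h ≡ 1 × d ≡ 1) →
    ∑< (suc n) (λ i → ∑< (suc k) (λ j → splitTerm n i j π)) ≡ 𝟙 (counted π) + 𝟙 (counted⁻ π)
  ∑splitTerm≡counted n π ad refl excluded = begin
    ∑< (suc n) (λ i → ∑< (suc k) (λ j → splitTerm n i j π))
      ≡⟨ ∑<-reindex n (suc k) (λ i → 2 * i + h) (λ m i j → pairOK i j (σ m) (τ m)) ⟩
    ∑< (suc n) (λ m → ∑< (suc n) (λ i → ∑< (suc k) (λ j → 𝟙 (2 * i + h ≡ᵇ m) * pairOK i j (σ m) (τ m))))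
      ≡⟨ ∑<-congᴮ (suc n) (λ m _ → ∑pairOK≡cutWeight n m (σ m) (τ m) (des-σ≤n m)) ⟩
    ∑< (suc n) (λ m → cutWeight (isBallot (σ m)) (des (σ m)) (pk (σ m)) (isBallot (τ m)) (des (τ m)) (pk (τ m)) m)
      ≡⟨ ∑<-congᴮ (suc n) (λ m m≤n →
           cong (cutWeight (isBallot (σ m)) (des (σ m)) (pk (σ m)) (isBallot (τ m)) (des (τ m)) (pk (τ m)))
                (sym (length-take-≤ m (≤-pred m≤n)))) ⟩
    ∑< (suc n) (λ m → cutWeightOf (take m π) (drop m π))
      ≡⟨ all-cuts π ad excluded ⟩
    𝟙 (counted π) + 𝟙 (counted⁻ π) ∎
    where
    open ≡-Reasoning
    σ τ : ℕ → List ℕ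
    σ m = reverse (take m π)
    τ m = drop m π
    des-σ≤n : ∀ m → des (σ m) ≤ length π
    des-σ≤n m = ≤-trans (des≤length (σ m))
      (≤-trans (≤-reflexive (trans (length-reverse (take m π)) (length-take m π))) (m⊓n≤n m (length π)))
    length-take-≤ : ∀ m → m ≤ length π → length (take m π) ≡ m
    length-take-≤ m m≤n = trans (length-take m π) (m≤n⇒m⊓n≡m m≤n)
    all-cuts : ∀ π → AdjDistinct π → ¬ (length π ≡ 0 × k ≡ 0 × h ≡ 1 × d ≡ 1) →
      ∑< (suc (length π)) (λ m → cutWeightOf (take m π) (drop m π)) ≡ 𝟙 (counted π) + 𝟙 (counted⁻ π)
    all-cuts []       _  ex = cutWeightOf-[] (λ (k≡0 , h≡1 , d≡1) → ex (refl , k≡0 , h≡1 , d≡1))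
    all-cuts (x ∷ xs) ad _  = ∑cutWeightOf-∷ x xs ad

-- Permutations of a list of labels

permsOf : List ℕ → List (List ℕ)
permsOf []      = [] ∷ []
permsOf (x ∷ V) = concatMap (insertions x) (permsOf V)

countdown : ℕ → List ℕ
countdown zero    = []
countdown (suc n) = suc n ∷ countdown n

S≡permsOf-countdown : ∀ n → S n ≡ permsOf (countdown n)
S≡permsOf-countdown zero    = refl
S≡permsOf-countdown (suc n) = cong (concatMap (insertions (suc n))) (S≡permsOf-countdown n)

length-countdown : ∀ n → length (countdown n) ≡ n
length-countdown zero    = refl
length-countdown (suc n) = cong suc (length-countdown n)

Decreasing : List ℕ → Set
Decreasing []      = ⊤
Decreasing (u ∷ U) = All (_< u) U × Decreasing U

countdown-decreasing : ∀ n → Decreasing (countdown n)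
countdown-decreasing zero    = tt
countdown-decreasing (suc n) = below n , countdown-decreasing n
  where
  below : ∀ n → All (_< suc n) (countdown n)
  below zero    = []
  below (suc n) = ≤-refl ∷ All.map (λ x<1+n → ≤-trans x<1+n (n≤1+n _)) (below n)

All-concatMap : ∀ {P : Y → Set} {Q : X → Set} (f : X → List Y) →
  (∀ {x} → Q x → All P (f x)) → ∀ {xs} → All Q xs → All P (concatMap f xs)
All-concatMap f g qs = concat⁺ (map⁺ (All.map g qs))

Arrangement : List ℕ → List ℕ → Set
Arrangement V π = (length π ≡ length V) × All (_∈ V) π × AdjDistinct π

insertions-length : ∀ x ys → All (λ ρ → length ρ ≡ suc (length ys)) (insertions x ys)
insertions-length x []       = refl ∷ []
insertions-length x (y ∷ ys) = refl ∷ map⁺ (All.map (cong suc) (insertions-length x ys))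

insertions-∈ : ∀ x V ys → All (_∈ V) ys → All (All (_∈ x ∷ V)) (insertions x ys)
insertions-∈ x V []       []       = (here refl ∷ []) ∷ []
insertions-∈ x V (y ∷ ys) (p ∷ ps) =
  (here refl ∷ there p ∷ All.map there ps) ∷ map⁺ (All.map (there p ∷_) (insertions-∈ x V ys ps))

insertions-AdjDistinctFrom : ∀ y x ys → y < x → All (_< x) ys → AdjDistinctFrom y ys →
  All (AdjDistinctFrom y) (insertions x ys)
insertions-AdjDistinctFrom y x []       y<x []          _          = (<⇒≢ y<x , tt) ∷ []
insertions-AdjDistinctFrom y x (z ∷ zs) y<x (z<x ∷ zs<x) (y≢z , ad) =
  (<⇒≢ y<x , (λ x≡z → <⇒≢ z<x (sym x≡z)) , ad)
    ∷ map⁺ (All.map (y≢z ,_) (insertions-AdjDistinctFrom z x zs z<x zs<x ad))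

insertions-AdjDistinct : ∀ x ys → All (_< x) ys → AdjDistinct ys → All AdjDistinct (insertions x ys)
insertions-AdjDistinct x []       []           _  = tt ∷ []
insertions-AdjDistinct x (z ∷ zs) (z<x ∷ zs<x) ad =
  ((λ x≡z → <⇒≢ z<x (sym x≡z)) , ad) ∷ map⁺ (insertions-AdjDistinctFrom z x zs z<x zs<x ad)

permsOf-arrangement : ∀ V → Decreasing V → All (Arrangement V) (permsOf V)
permsOf-arrangement []      _           = (refl , [] , tt) ∷ []
permsOf-arrangement (x ∷ V) (V<x , dec) = All-concatMap (insertions x) insert (permsOf-arrangement V dec)
  where
  insert : ∀ {π} → Arrangement V π → All (Arrangement (x ∷ V)) (insertions x π)
  insert {π} (len , mem , ad) =
    All.map (λ ((len′ , mem′) , ad′) → trans len′ (cong suc len) , mem′ , ad′)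
      (All.zip (All.zip (insertions-length x π , insertions-∈ x V π mem) ,
                insertions-AdjDistinct x π (All.map (All.lookup V<x) mem) ad))

permsOf-length : ∀ V → All (λ π → length π ≡ length V) (permsOf V)
permsOf-length []      = refl ∷ []
permsOf-length (x ∷ V) = All-concatMap (insertions x)
  (λ {π} len → All.map (λ len′ → trans len′ (cong suc len)) (insertions-length x π)) (permsOf-length V)

toChosen toRest : ℕ → List ℕ × List ℕ → List ℕ × List ℕ
toChosen x (A , B) = (x ∷ A , B)
toRest   x (A , B) = (A , x ∷ B)

-- choose m V lists the ways to split the labels V into m chosen ones and the
-- rest, both in the order of V.
choose : ℕ → List ℕ → List (List ℕ × List ℕ)
choose zero    V       = ([] , V) ∷ []
choose (suc m) []      = []
choose (suc m) (x ∷ V) = map (toChosen x) (choose m V) ++ map (toRest x) (choose (suc m) V)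

choose-length : ∀ m V → length (choose m V) ≡ length V C m
choose-length zero    V       = refl
choose-length (suc m) []      = refl
choose-length (suc m) (x ∷ V) = begin
  length (map _ (choose m V) ++ map _ (choose (suc m) V))    ≡⟨ length-++ (map _ (choose m V)) ⟩
  length (map _ (choose m V)) + length (map _ (choose (suc m) V))
    ≡⟨ cong₂ _+_ (trans (length-map _ (choose m V)) (choose-length m V))
                 (trans (length-map _ (choose (suc m) V)) (choose-length (suc m) V)) ⟩
  length V C m + length V C suc m                            ≡⟨ nCk+nC[k+1]≡[n+1]C[k+1] (length V) m ⟩
  suc (length V) C suc m                                     ∎
  where open ≡-Reasoning

ChoiceOf : ℕ → List ℕ → List ℕ × List ℕ → Set
ChoiceOf m V (A , B) = (length A ≡ m) × (length A + length B ≡ length V)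

choose-choiceOf : ∀ m V → All (ChoiceOf m V) (choose m V)
choose-choiceOf zero    V       = (refl , refl) ∷ []
choose-choiceOf (suc m) []      = []
choose-choiceOf (suc m) (x ∷ V) = ++⁺
  (map⁺ (All.map (λ (lenA , lenAB) → cong suc lenA , cong suc lenAB) (choose-choiceOf m V)))
  (map⁺ (All.map (λ {(A , B)} (lenA , lenAB) → lenA , trans (+-suc (length A) (length B)) (cong suc lenAB))
                 (choose-choiceOf (suc m) V)))

choose-too-many : ∀ m V → length V < m → choose m V ≡ []
choose-too-many (suc m) []      _ = refl
choose-too-many (suc m) (x ∷ V) (s≤s V<m)
  rewrite choose-too-many m V V<m | choose-too-many (suc m) V (≤-trans V<m (n≤1+n m)) = refl

choose-All : ∀ {P : ℕ → Set} m V → All P V → All (λ (A , B) → All P A × All P B) (choose m V)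
choose-All zero    V       ps       = ([] , ps) ∷ []
choose-All (suc m) []      _        = []
choose-All (suc m) (x ∷ V) (p ∷ ps) = ++⁺
  (map⁺ (All.map (λ (pA , pB) → p ∷ pA , pB) (choose-All m V ps)))
  (map⁺ (All.map (λ (pA , pB) → pA , p ∷ pB) (choose-All (suc m) V ps)))

choose-Decreasing : ∀ m V → Decreasing V → All (λ (A , B) → Decreasing A × Decreasing B) (choose m V)
choose-Decreasing zero    V       dec         = (tt , dec) ∷ []
choose-Decreasing (suc m) []      _           = []
choose-Decreasing (suc m) (x ∷ V) (V<x , dec) = ++⁺
  (map⁺ (All.map (λ ((decA , decB) , (A<x , _)) → (A<x , decA) , decB)
                 (All.zip (choose-Decreasing m V dec , choose-All m V V<x))))
  (map⁺ (All.map (λ ((decA , decB) , (_ , B<x)) → decA , (B<x , decB))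
                 (All.zip (choose-Decreasing (suc m) V dec , choose-All (suc m) V V<x))))

take-++-length : ∀ (a b : List X) m → length a ≡ m → take m (a ++ b) ≡ a
take-++-length []      b zero    _ = refl
take-++-length (x ∷ a) b (suc m) e = cong (x ∷_) (take-++-length a b m (suc-injective e))

drop-++-length : ∀ (a b : List X) m → length a ≡ m → drop m (a ++ b) ≡ b
drop-++-length []      b zero    _ = refl
drop-++-length (x ∷ a) b (suc m) e = drop-++-length a b m (suc-injective e)

∑concat : (List ℕ → ℕ) → List ℕ × List ℕ → ℕ
∑concat f (A , B) = ∑ (permsOf A) (λ a → ∑ (permsOf B) (λ b → f (a ++ b)))

∑insertionsAfter : ℕ → ℕ → List ℕ → (List ℕ → ℕ) → ℕ
∑insertionsAfter x m π f =
  if m <ᵇ length π then ∑ (insertions x (drop (suc m) π)) (λ b → f (take (suc m) π ++ b)) else 0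

∑insertions-split : ∀ x m π f → m ≤ length π →
  ∑ (insertions x π) f ≡ ∑ (insertions x (take m π)) (λ a → f (a ++ drop m π)) + ∑insertionsAfter x m π f
∑insertions-split x zero    []       f _ = sym (+-identityʳ _)
∑insertions-split x zero    (y ∷ ys) f _ =
  trans (cong (_+_ (f (x ∷ y ∷ ys))) (∑-map (y ∷_) (insertions x ys) f))
        (cong (_+ ∑ (insertions x ys) (λ b → f (y ∷ b))) (sym (+-identityʳ _)))
∑insertions-split x (suc m) (y ∷ ys) f (s≤s m≤ys) = begin
  f (x ∷ y ∷ ys) + ∑ (map (y ∷_) (insertions x ys)) f
    ≡⟨ cong (_+_ (f (x ∷ y ∷ ys))) (∑-map (y ∷_) (insertions x ys) f) ⟩
  f (x ∷ y ∷ ys) + ∑ (insertions x ys) (λ ρ → f (y ∷ ρ))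
    ≡⟨ cong (_+_ (f (x ∷ y ∷ ys))) (∑insertions-split x m ys (λ ρ → f (y ∷ ρ)) m≤ys) ⟩
  f (x ∷ y ∷ ys) + (∑ (insertions x (take m ys)) (λ a → f (y ∷ a ++ drop m ys)) + rest)
    ≡⟨ sym (+-assoc (f (x ∷ y ∷ ys)) _ _) ⟩
  f (x ∷ y ∷ ys) + ∑ (insertions x (take m ys)) (λ a → f (y ∷ a ++ drop m ys)) + rest
    ≡⟨ cong₂ (λ p q → p + q + rest) (cong (λ z → f (x ∷ y ∷ z)) (sym (take++drop≡id m ys)))
                                     (sym (∑-map (y ∷_) (insertions x (take m ys)) (λ a → f (a ++ drop m ys)))) ⟩
  f (x ∷ y ∷ take m ys ++ drop m ys) + ∑ (map (y ∷_) (insertions x (take m ys))) (λ a → f (a ++ drop m ys)) + rest ∎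
  where
  open ≡-Reasoning
  rest = ∑insertionsAfter x m ys (λ ρ → f (y ∷ ρ))

DecomposesAt : List ℕ → Set
DecomposesAt V = ∀ m f → m ≤ length V → ∑ (permsOf V) f ≡ ∑ (choose m V) (∑concat f)

∑permsOf-insert-early : ∀ x V m f → DecomposesAt V → m ≤ length V →
  ∑ (permsOf V) (λ π → ∑ (insertions x (take m π)) (λ a → f (a ++ drop m π)))
    ≡ ∑ (map (toChosen x) (choose m V)) (∑concat f)
∑permsOf-insert-early x V m f decomposes m≤V = begin
  ∑ (permsOf V) early
    ≡⟨ decomposes m early m≤V ⟩
  ∑ (choose m V) (∑concat early)
    ≡⟨ ∑-congᴬ (choose m V) (choose-choiceOf m V) (λ (A , B) (lenA , _) →
         ∑-congᴬ (permsOf A) (permsOf-length A) (λ a lena →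
           trans (∑-cong (permsOf B) (λ b → cong₂ (λ p q → ∑ (insertions x p) (λ a′ → f (a′ ++ q)))
                    (take-++-length a b m (trans lena lenA)) (drop-++-length a b m (trans lena lenA))))
                 (∑-swap (permsOf B) (insertions x a) (λ b a′ → f (a′ ++ b))))) ⟩
  ∑ (choose m V) (λ (A , B) → ∑ (permsOf A) (λ a → ∑ (insertions x a) (λ a′ → ∑ (permsOf B) (λ b → f (a′ ++ b)))))
    ≡⟨ ∑-cong (choose m V) (λ (A , B) →
         sym (∑-concatMap (insertions x) (permsOf A) (λ a′ → ∑ (permsOf B) (λ b → f (a′ ++ b))))) ⟩
  ∑ (choose m V) (λ (A , B) → ∑concat f (x ∷ A , B))
    ≡⟨ sym (∑-map (toChosen x) (choose m V) (∑concat f)) ⟩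
  ∑ (map (toChosen x) (choose m V)) (∑concat f) ∎
  where
  open ≡-Reasoning
  early : List ℕ → ℕ
  early π = ∑ (insertions x (take m π)) (λ a → f (a ++ drop m π))

∑permsOf-insert-late : ∀ x V m f → DecomposesAt V →
  ∑ (permsOf V) (λ π → ∑insertionsAfter x m π f) ≡ ∑ (map (toRest x) (choose (suc m) V)) (∑concat f)
∑permsOf-insert-late x V m f decomposes with m <? length V
... | yes m<V = begin
  ∑ (permsOf V) late
    ≡⟨ decomposes (suc m) late m<V ⟩
  ∑ (choose (suc m) V) (∑concat late)
    ≡⟨ ∑-congᴬ (choose (suc m) V) (choose-choiceOf (suc m) V) (λ (A , B) (lenA , lenAB) →
          ∑-congᴬ (permsOf A) (permsOf-length A) (λ a lena →
            trans (∑-congᴬ (permsOf B) (permsOf-length B) (λ b lenb →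
                     after a b (trans lena lenA) (trans (length-++ a) (trans (cong₂ _+_ lena lenb) lenAB))))
                  (sym (∑-concatMap (insertions x) (permsOf B) (λ b → f (a ++ b)))))) ⟩
  ∑ (choose (suc m) V) (λ (A , B) → ∑concat f (A , x ∷ B))
    ≡⟨ sym (∑-map (toRest x) (choose (suc m) V) (∑concat f)) ⟩
  ∑ (map (toRest x) (choose (suc m) V)) (∑concat f) ∎
  where
  open ≡-Reasoning
  late : List ℕ → ℕ
  late π = ∑insertionsAfter x m π f
  after : ∀ a b → length a ≡ suc m → length (a ++ b) ≡ length V →
    ∑insertionsAfter x m (a ++ b) f ≡ ∑ (insertions x b) (λ b′ → f (a ++ b′))
  after a b lena lenab
    rewrite lenab | T⇒≡true (<⇒<ᵇ m<V) | take-++-length a b (suc m) lena | drop-++-length a b (suc m) lena = refl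
... | no m≮V = begin
  ∑ (permsOf V) (λ π → ∑insertionsAfter x m π f)
    ≡⟨ ∑-congᴬ (permsOf V) (permsOf-length V) none ⟩
  ∑ (permsOf V) (λ _ → 0)
    ≡⟨ ∑-zero (permsOf V) ⟩
  0
    ≡⟨ cong (λ l → ∑ (map (toRest x) l) (∑concat f)) (sym (choose-too-many (suc m) V (s≤s (≮⇒≥ m≮V)))) ⟩
  ∑ (map (toRest x) (choose (suc m) V)) (∑concat f) ∎
  where
  open ≡-Reasoning
  none : ∀ π → length π ≡ length V → ∑insertionsAfter x m π f ≡ 0
  none π lenπ rewrite lenπ | ¬T⇒≡false (λ t → m≮V (<ᵇ⇒< m (length V) t)) = refl

-- Cutting each permutation of V after m entries and grouping by the label
-- sets of the two parts.
∑permsOf-decompose : ∀ V → DecomposesAt V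
∑permsOf-decompose V       zero    f _ = sym (trans (+-identityʳ _) (+-identityʳ _))
∑permsOf-decompose (x ∷ V) (suc m) f (s≤s m≤V) = begin
  ∑ (concatMap (insertions x) (permsOf V)) f
    ≡⟨ ∑-concatMap (insertions x) (permsOf V) f ⟩
  ∑ (permsOf V) (λ π → ∑ (insertions x π) f)
    ≡⟨ ∑-congᴬ (permsOf V) (permsOf-length V)
         (λ π lenπ → ∑insertions-split x m π f (≤-trans m≤V (≤-reflexive (sym lenπ)))) ⟩
  ∑ (permsOf V) (λ π → early π + ∑insertionsAfter x m π f)
    ≡⟨ ∑-+ (permsOf V) early (λ π → ∑insertionsAfter x m π f) ⟩
  ∑ (permsOf V) early + ∑ (permsOf V) (λ π → ∑insertionsAfter x m π f)
    ≡⟨ cong₂ _+_ (∑permsOf-insert-early x V m f (∑permsOf-decompose V) m≤V)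
                 (∑permsOf-insert-late x V m f (∑permsOf-decompose V)) ⟩
  ∑ (map (toChosen x) (choose m V)) (∑concat f) + ∑ (map (toRest x) (choose (suc m) V)) (∑concat f)
    ≡⟨ sym (∑-++ (map (toChosen x) (choose m V)) _ (∑concat f)) ⟩
  ∑ (choose (suc m) (x ∷ V)) (∑concat f) ∎
  where
  open ≡-Reasoning
  early : List ℕ → ℕ
  early π = ∑ (insertions x (take m π)) (λ a → f (a ++ drop m π))

-- The order-preserving map sending the labels U to the labels W.
relabel : List ℕ → List ℕ → ℕ → ℕ
relabel (u ∷ U) (w ∷ W) x = if x ≡ᵇ u then w else relabel U W x
relabel _       _       x = x

relabel-here : ∀ u U w W → relabel (u ∷ U) (w ∷ W) u ≡ w
relabel-here u U w W rewrite ≡ᵇ-refl u = refl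

relabel-there : ∀ u U w W x → x < u → relabel (u ∷ U) (w ∷ W) x ≡ relabel U W x
relabel-there u U w W x x<u rewrite <⇒≡ᵇ-false x<u = refl

map-relabel : ∀ U W → Decreasing U → length U ≡ length W → map (relabel U W) U ≡ W
map-relabel []      []      _           _ = refl
map-relabel (u ∷ U) (w ∷ W) (U<u , dec) e =
  cong₂ _∷_ (relabel-here u U w W) (trans (later U U<u) (map-relabel U W dec (suc-injective e)))
  where
  later : ∀ V → All (_< u) V → map (relabel (u ∷ U) (w ∷ W)) V ≡ map (relabel U W) V
  later []      []           = refl
  later (v ∷ V) (v<u ∷ V<u) = cong₂ _∷_ (relabel-there u U w W v v<u) (later V V<u)

relabel-∈ : ∀ U W → length U ≡ length W → ∀ {x} → x ∈ U → relabel U W x ∈ W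
relabel-∈ (u ∷ U) (w ∷ W) e {x} (here refl) rewrite ≡ᵇ-refl u = here refl
relabel-∈ (u ∷ U) (w ∷ W) e {x} (there x∈U) with x ≡ᵇ u
... | true  = here refl
... | false = there (relabel-∈ U W (suc-injective e) x∈U)

relabel-<ᵇ : ∀ U W → Decreasing U → Decreasing W → length U ≡ length W →
  ∀ {x y} → x ∈ U → y ∈ U → (relabel U W x <ᵇ relabel U W y) ≡ (x <ᵇ y)
relabel-<ᵇ (u ∷ U) (w ∷ W) _ _ _ (here refl) (here refl)
  rewrite relabel-here u U w W = trans (<ᵇ-irrefl w) (sym (<ᵇ-irrefl u))
relabel-<ᵇ (u ∷ U) (w ∷ W) (U<u , _) (W<w , _) e {y = y} (here refl) (there y∈U) =
  trans (cong₂ _<ᵇ_ (relabel-here u U w W) (relabel-there u U w W y (All.lookup U<u y∈U)))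
    (trans (¬T⇒≡false (λ t → <-asym (<ᵇ⇒< w _ t) (All.lookup W<w (relabel-∈ U W (suc-injective e) y∈U))))
           (sym (¬T⇒≡false (λ t → <-asym (<ᵇ⇒< u y t) (All.lookup U<u y∈U)))))
relabel-<ᵇ (u ∷ U) (w ∷ W) (U<u , _) (W<w , _) e {x} (there x∈U) (here refl) =
  trans (cong₂ _<ᵇ_ (relabel-there u U w W x (All.lookup U<u x∈U)) (relabel-here u U w W))
    (trans (T⇒≡true (<⇒<ᵇ (All.lookup W<w (relabel-∈ U W (suc-injective e) x∈U))))
           (sym (T⇒≡true (<⇒<ᵇ (All.lookup U<u x∈U)))))
relabel-<ᵇ (u ∷ U) (w ∷ W) (U<u , decU) (_ , decW) e {x} {y} (there x∈U) (there y∈U) =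
  trans (cong₂ _<ᵇ_ (relabel-there u U w W x (All.lookup U<u x∈U)) (relabel-there u U w W y (All.lookup U<u y∈U)))
    (relabel-<ᵇ U W decU decW (suc-injective e) x∈U y∈U)

permsOf-map : ∀ (g : ℕ → ℕ) V → permsOf (map g V) ≡ map (map g) (permsOf V)
permsOf-map g []      = refl
permsOf-map g (x ∷ V) = trans (cong (concatMap (insertions (g x))) (permsOf-map g V)) (insert-all (permsOf V))
  where
  insertions-map : ∀ ys → insertions (g x) (map g ys) ≡ map (map g) (insertions x ys)
  insertions-map []       = refl
  insertions-map (y ∷ ys) = cong ((g x ∷ g y ∷ map g ys) ∷_)
    (trans (cong (map (g y ∷_)) (insertions-map ys)) (trans (sym (map-∘ (insertions x ys))) (map-∘ (insertions x ys))))
  insert-all : ∀ L → concatMap (insertions (g x)) (map (map g) L) ≡ map (map g) (concatMap (insertions x) L)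
  insert-all []      = refl
  insert-all (π ∷ L) = trans (cong₂ _++_ (insertions-map π) (insert-all L)) (sym (map-++ (map g) (insertions x π) _))

UpDownInvariant : (List ℕ → ℕ) → Set
UpDownInvariant F = ∀ π π′ → AdjDistinct π → AdjDistinct π′ → upDown π ≡ upDown π′ → F π ≡ F π′

module Relabel (U W : List ℕ) (decU : Decreasing U) (decW : Decreasing W) (len : length U ≡ length W) where
  private
    g = relabel U W

  upDownFrom-relabel : ∀ x xs → x ∈ U → All (_∈ U) xs → upDownFrom (g x) (map g xs) ≡ upDownFrom x xs
  upDownFrom-relabel x []       _   _           = refl
  upDownFrom-relabel x (y ∷ ys) x∈U (y∈U ∷ ys∈U) =
    cong₂ _∷_ (relabel-<ᵇ U W decU decW len x∈U y∈U) (upDownFrom-relabel y ys y∈U ys∈U)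

  upDown-relabel : ∀ π → All (_∈ U) π → upDown (map g π) ≡ upDown π
  upDown-relabel []       _            = refl
  upDown-relabel (x ∷ xs) (x∈U ∷ xs∈U) = upDownFrom-relabel x xs x∈U xs∈U

  relabel-≢ : ∀ {x y} → x ∈ U → y ∈ U → x ≢ y → g x ≢ g y
  relabel-≢ {x} {y} x∈U y∈U x≢y gx≡gy with <-cmp x y
  ... | tri< x<y _ _ = <-irrefl refl (<ᵇ⇒< (g y) (g y)
          (subst (λ z → T (z <ᵇ g y)) gx≡gy (subst T (sym (relabel-<ᵇ U W decU decW len x∈U y∈U)) (<⇒<ᵇ x<y))))
  ... | tri≈ _ x≡y _ = x≢y x≡y
  ... | tri> _ _ x>y = <-irrefl refl (<ᵇ⇒< (g y) (g y)
          (subst (λ z → T (g y <ᵇ z)) gx≡gy (subst T (sym (relabel-<ᵇ U W decU decW len y∈U x∈U)) (<⇒<ᵇ x>y))))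

  AdjDistinct-relabel : ∀ π → All (_∈ U) π → AdjDistinct π → AdjDistinct (map g π)
  AdjDistinct-relabel []       _            _  = tt
  AdjDistinct-relabel (x ∷ xs) (x∈U ∷ xs∈U) ad = from x xs x∈U xs∈U ad
    where
    from : ∀ x xs → x ∈ U → All (_∈ U) xs → AdjDistinctFrom x xs → AdjDistinctFrom (g x) (map g xs)
    from x []       _   _            _          = tt
    from x (y ∷ ys) x∈U (y∈U ∷ ys∈U) (x≢y , ad) = relabel-≢ x∈U y∈U x≢y , from y ys y∈U ys∈U ad

  ∑permsOf-relabel : ∀ F → UpDownInvariant F → ∑ (permsOf W) F ≡ ∑ (permsOf U) F
  ∑permsOf-relabel F invariant = begin
    ∑ (permsOf W) F                    ≡⟨ cong (λ V → ∑ (permsOf V) F) (sym (map-relabel U W decU len)) ⟩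
    ∑ (permsOf (map g U)) F            ≡⟨ cong (λ L → ∑ L F) (permsOf-map g U) ⟩
    ∑ (map (map g) (permsOf U)) F      ≡⟨ ∑-map (map g) (permsOf U) F ⟩
    ∑ (permsOf U) (λ π → F (map g π))  ≡⟨ ∑-congᴬ (permsOf U) (permsOf-arrangement U decU) same-word ⟩
    ∑ (permsOf U) F                    ∎
    where
    open ≡-Reasoning
    same-word : ∀ π → Arrangement U π → F (map g π) ≡ F π
    same-word π (_ , π⊆U , ad) = invariant (map g π) π (AdjDistinct-relabel π π⊆U ad) ad (upDown-relabel π π⊆U)

∑insertions-∷ʳ : ∀ x π y (F : List ℕ → ℕ) →
  ∑ (insertions x (π ∷ʳ y)) F ≡ ∑ (insertions x π) (λ a → F (a ∷ʳ y)) + F (π ++ y ∷ x ∷ [])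
∑insertions-∷ʳ x []      y F =
  trans (cong (_+_ (F (x ∷ y ∷ []))) (+-identityʳ _)) (cong (_+ F (y ∷ x ∷ [])) (sym (+-identityʳ _)))
∑insertions-∷ʳ x (z ∷ π) y F = begin
  F (x ∷ z ∷ π ∷ʳ y) + ∑ (map (z ∷_) (insertions x (π ∷ʳ y))) F
    ≡⟨ cong (_+_ (F (x ∷ z ∷ π ∷ʳ y)))
         (trans (∑-map (z ∷_) (insertions x (π ∷ʳ y)) F) (∑insertions-∷ʳ x π y (λ a → F (z ∷ a)))) ⟩
  F (x ∷ z ∷ π ∷ʳ y) + (∑ (insertions x π) (λ a → F (z ∷ a ∷ʳ y)) + F (z ∷ π ++ y ∷ x ∷ []))
    ≡⟨ sym (+-assoc (F (x ∷ z ∷ π ∷ʳ y)) _ _) ⟩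
  F (x ∷ z ∷ π ∷ʳ y) + ∑ (insertions x π) (λ a → F (z ∷ a ∷ʳ y)) + F (z ∷ π ++ y ∷ x ∷ [])
    ≡⟨ cong (λ q → F (x ∷ z ∷ π ∷ʳ y) + q + F (z ∷ π ++ y ∷ x ∷ []))
            (sym (∑-map (z ∷_) (insertions x π) (λ a → F (a ∷ʳ y)))) ⟩
  F (x ∷ z ∷ π ∷ʳ y) + ∑ (map (z ∷_) (insertions x π)) (λ a → F (a ∷ʳ y)) + F (z ∷ π ++ y ∷ x ∷ []) ∎
  where open ≡-Reasoning

∑insertions-reverse : ∀ x π (F : List ℕ → ℕ) →
  ∑ (insertions x π) (λ a → F (reverse a)) ≡ ∑ (insertions x (reverse π)) F
∑insertions-reverse x []      F = refl
∑insertions-reverse x (y ∷ π) F = begin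
  F (reverse (x ∷ y ∷ π)) + ∑ (map (y ∷_) (insertions x π)) (λ a → F (reverse a))
    ≡⟨ cong₂ _+_ (cong F (reverse-∷-∷ x y π)) (trans (∑-map (y ∷_) (insertions x π) (λ a → F (reverse a)))
         (∑-cong (insertions x π) (λ a → cong F (unfold-reverse y a)))) ⟩
  F (reverse π ++ y ∷ x ∷ []) + ∑ (insertions x π) (λ a → F (reverse a ∷ʳ y))
    ≡⟨ cong (_+_ (F (reverse π ++ y ∷ x ∷ []))) (∑insertions-reverse x π (λ c → F (c ∷ʳ y))) ⟩
  F (reverse π ++ y ∷ x ∷ []) + ∑ (insertions x (reverse π)) (λ c → F (c ∷ʳ y))
    ≡⟨ +-comm (F (reverse π ++ y ∷ x ∷ [])) _ ⟩
  ∑ (insertions x (reverse π)) (λ c → F (c ∷ʳ y)) + F (reverse π ++ y ∷ x ∷ [])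
    ≡⟨ sym (∑insertions-∷ʳ x (reverse π) y F) ⟩
  ∑ (insertions x (reverse π ∷ʳ y)) F
    ≡⟨ cong (λ l → ∑ (insertions x l) F) (sym (unfold-reverse y π)) ⟩
  ∑ (insertions x (reverse (y ∷ π))) F ∎
  where open ≡-Reasoning

∑permsOf-reverse : ∀ V (F : List ℕ → ℕ) → ∑ (permsOf V) (λ π → F (reverse π)) ≡ ∑ (permsOf V) F
∑permsOf-reverse []      F = refl
∑permsOf-reverse (x ∷ V) F = begin
  ∑ (concatMap (insertions x) (permsOf V)) (λ π → F (reverse π))
    ≡⟨ ∑-concatMap (insertions x) (permsOf V) _ ⟩
  ∑ (permsOf V) (λ π → ∑ (insertions x π) (λ a → F (reverse a)))
    ≡⟨ ∑-cong (permsOf V) (λ π → ∑insertions-reverse x π F) ⟩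
  ∑ (permsOf V) (λ π → ∑ (insertions x (reverse π)) F)
    ≡⟨ ∑permsOf-reverse V (λ ρ → ∑ (insertions x ρ) F) ⟩
  ∑ (permsOf V) (λ ρ → ∑ (insertions x ρ) F)
    ≡⟨ sym (∑-concatMap (insertions x) (permsOf V) F) ⟩
  ∑ (concatMap (insertions x) (permsOf V)) F ∎
  where open ≡-Reasoning

count≡∑ : ∀ {P : List ℕ → Bool} xs → count P xs ≡ ∑ xs (λ π → 𝟙 (P π))
count≡∑         []       = refl
count≡∑ {P = P} (x ∷ xs) with P x
... | true  = cong suc (count≡∑ xs)
... | false = count≡∑ xs

S-arrangement : ∀ n → All (λ π → AdjDistinct π × length π ≡ n) (S n)
S-arrangement n = subst (All _) (sym (S≡permsOf-countdown n))
  (All.map (λ (len , _ , ad) → ad , trans len (length-countdown n))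
           (permsOf-arrangement (countdown n) (countdown-decreasing n)))

module Counting (h d k : ℕ) where
  open Terms h d k

  leftOK-reverse-invariant : ∀ i j → UpDownInvariant (λ α → 𝟙 (leftOK i j (reverse α)))
  leftOK-reverse-invariant i j α α′ ad ad′ same
    rewrite isBallot-reverse α ad | pk-reverse α ad | des-reverse α ad
          | isBallot-reverse α′ ad′ | pk-reverse α′ ad′ | des-reverse α′ ad′ | same = refl

  rightOK-invariant : ∀ i j → UpDownInvariant (λ β → 𝟙 (rightOK i j β))
  rightOK-invariant i j β β′ ad ad′ same
    rewrite isBallot-upDown β ad | pk-upDown β ad | des-upDown β ad
          | isBallot-upDown β′ ad′ | pk-upDown β′ ad′ | des-upDown β′ ad′ | same = refl

  -- Once the labels A of α and B of β are chosen, both sums relabel to the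
  -- ballot counts on the standard label sets.
  ∑concat-pairOK : ∀ n m i j (A B : List ℕ) → ChoiceOf m (countdown n) (A , B) → Decreasing A × Decreasing B →
    ∑concat (λ π → pairOK i j (reverse (take m π)) (drop m π)) (A , B)
      ≡ b (+ m) (+ j) (+ i) * b (+ (n ∸ m)) (+ k - + j) (+ d - + i - + h)
  ∑concat-pairOK n m i j A B (lenA , lenAB) (decA , decB) = begin
    ∑ (permsOf A) (λ α → ∑ (permsOf B) (λ β → pairOK i j (reverse (take m (α ++ β))) (drop m (α ++ β))))
      ≡⟨ ∑-congᴬ (permsOf A) (permsOf-length A) (λ α lenα → ∑-cong (permsOf B) (λ β →
           cong₂ (λ σ τ → pairOK i j (reverse σ) τ)
             (take-++-length α β m (trans lenα lenA)) (drop-++-length α β m (trans lenα lenA)))) ⟩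
    ∑ (permsOf A) (λ α → ∑ (permsOf B) (λ β → left α * right β))
      ≡⟨ ∑-cong (permsOf A) (λ α → ∑-*ˡ (permsOf B) (left α) right) ⟩
    ∑ (permsOf A) (λ α → left α * ∑ (permsOf B) right)
      ≡⟨ ∑-*ʳ (permsOf A) (∑ (permsOf B) right) left ⟩
    ∑ (permsOf A) left * ∑ (permsOf B) right
      ≡⟨ cong₂ _*_ left-count right-count ⟩
    b (+ m) (+ j) (+ i) * b (+ (n ∸ m)) (+ k - + j) (+ d - + i - + h) ∎
    where
    open ≡-Reasoning
    left right : List ℕ → ℕ
    left  α = 𝟙 (leftOK i j (reverse α))
    right β = 𝟙 (rightOK i j β)
    lenB : length (countdown (n ∸ m)) ≡ length B
    lenB = begin
      length (countdown (n ∸ m))      ≡⟨ length-countdown (n ∸ m) ⟩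
      n ∸ m                           ≡⟨ cong (_∸ m) (sym (trans lenAB (length-countdown n))) ⟩
      length A + length B ∸ m         ≡⟨ cong (λ z → z + length B ∸ m) lenA ⟩
      m + length B ∸ m                ≡⟨ m+n∸m≡n m (length B) ⟩
      length B                        ∎
    left-count : ∑ (permsOf A) left ≡ b (+ m) (+ j) (+ i)
    left-count = begin
      ∑ (permsOf A) left
        ≡⟨ Relabel.∑permsOf-relabel (countdown m) A (countdown-decreasing m) decA
             (trans (length-countdown m) (sym lenA)) left (leftOK-reverse-invariant i j) ⟩
      ∑ (permsOf (countdown m)) left
        ≡⟨ ∑permsOf-reverse (countdown m) (λ σ → 𝟙 (leftOK i j σ)) ⟩
      ∑ (permsOf (countdown m)) (λ σ → 𝟙 (leftOK i j σ))
        ≡⟨ sym (trans (count≡∑ (S m)) (cong (λ L → ∑ L (λ σ → 𝟙 (leftOK i j σ))) (S≡permsOf-countdown m))) ⟩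
      b (+ m) (+ j) (+ i) ∎
    right-count : ∑ (permsOf B) right ≡ b (+ (n ∸ m)) (+ k - + j) (+ d - + i - + h)
    right-count = begin
      ∑ (permsOf B) right
        ≡⟨ Relabel.∑permsOf-relabel (countdown (n ∸ m)) B (countdown-decreasing (n ∸ m)) decB lenB
             right (rightOK-invariant i j) ⟩
      ∑ (permsOf (countdown (n ∸ m))) right
        ≡⟨ sym (trans (count≡∑ (S (n ∸ m))) (cong (λ L → ∑ L right) (S≡permsOf-countdown (n ∸ m)))) ⟩
      b (+ (n ∸ m)) (+ k - + j) (+ d - + i - + h) ∎

  term≡∑splitTerm : ∀ n i j →
    binom (+ n) (+ (2 * i + h)) * b (+ (2 * i + h)) (+ j) (+ i) * b (+ n - + (2 * i + h)) (+ k - + j) (+ d - + i - + h)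
      ≡ ∑ (S n) (splitTerm n i j)
  term≡∑splitTerm n i j with 2 * i + h ≤? n
  ... | no m≰n rewrite k>n⇒nCk≡0 {n} {2 * i + h} (≰⇒> m≰n) | ¬T⇒≡false (λ t → m≰n (≤ᵇ⇒≤ (2 * i + h) n t)) =
    sym (∑-zero (S n))
  ... | yes m≤n rewrite +-pos-∸ n (2 * i + h) m≤n = sym (begin
    ∑ (S n) (splitTerm n i j)
      ≡⟨ ∑-cong (S n) (λ π → trans (cong (λ c → 𝟙 c * F π) (T⇒≡true (≤⇒≤ᵇ m≤n))) (+-identityʳ _)) ⟩
    ∑ (S n) F
      ≡⟨ cong (λ L → ∑ L F) (S≡permsOf-countdown n) ⟩
    ∑ (permsOf (countdown n)) F
      ≡⟨ ∑permsOf-decompose (countdown n) m F (≤-trans m≤n (≤-reflexive (sym (length-countdown n)))) ⟩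
    ∑ (choose m (countdown n)) (∑concat F)
      ≡⟨ ∑-congᴬ (choose m (countdown n))
           (All.zip (choose-choiceOf m (countdown n) , choose-Decreasing m (countdown n) (countdown-decreasing n)))
           (λ (A , B) (choice , dec) → ∑concat-pairOK n m i j A B choice dec) ⟩
    ∑ (choose m (countdown n)) (λ _ → b₁ * b₂)
      ≡⟨ ∑-const (choose m (countdown n)) (b₁ * b₂) ⟩
    length (choose m (countdown n)) * (b₁ * b₂)
      ≡⟨ cong (_* (b₁ * b₂)) (trans (choose-length m (countdown n)) (cong (_C m) (length-countdown n))) ⟩
    (n C m) * (b₁ * b₂)
      ≡⟨ sym (*-assoc (n C m) b₁ b₂) ⟩
    (n C m) * b₁ * b₂ ∎)
    where
    open ≡-Reasoning
    m = 2 * i + h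
    F : List ℕ → ℕ
    F π = pairOK i j (reverse (take m π)) (drop m π)
    b₁ = b (+ m) (+ j) (+ i)
    b₂ = b (+ (n ∸ m)) (+ k - + j) (+ d - + i - + h)

theorem3p6 : (n k h d : ℕ) → ¬ ((n , k , h , d) ≡ (0 , 0 , 1 , 1)) →
    p (+ n) (+ k) (+ h) (+ d) + p (+ n) (+ k) (+ h - + 1) (+ d - + 1)
      ≡ Σ≤ n (λ i → Σ≤ k (λ j →
          binom (+ n) (+ (2 * i + h))
          * b (+ (2 * i + h)) (+ j) (+ i)
          * b (+ n - + (2 * i + h)) (+ k - + j) (+ d - + i - + h)))
theorem3p6 n k h d excluded = begin
  count counted (S n) + count counted⁻ (S n)
    ≡⟨ trans (cong₂ _+_ (count≡∑ (S n)) (count≡∑ (S n))) (sym (∑-+ (S n) _ _)) ⟩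
  ∑ (S n) (λ π → 𝟙 (counted π) + 𝟙 (counted⁻ π))
    ≡⟨ ∑-congᴬ (S n) (S-arrangement n) (λ π (ad , len) →
         sym (∑splitTerm≡counted n π ad len (λ { (refl , refl , refl , refl) → excluded refl }))) ⟩
  ∑ (S n) (λ π → ∑< (suc n) (λ i → ∑< (suc k) (λ j → splitTerm n i j π)))
    ≡⟨ ∑-∑<²-swap (S n) (suc n) (suc k) (splitTerm n) ⟩
  ∑< (suc n) (λ i → ∑< (suc k) (λ j → ∑ (S n) (splitTerm n i j)))
    ≡⟨ ∑<-cong (suc n) (λ i → ∑<-cong (suc k) (λ j → sym (term≡∑splitTerm n i j))) ⟩
  ∑< (suc n) (λ i → ∑< (suc k) (term i))
    ≡⟨ sym (Σ≤²-∑<² n k term) ⟩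
  Σ≤ n (λ i → Σ≤ k (term i)) ∎
  where
  open ≡-Reasoning
  open PerPermutation h d k
  open Terms h d k
  open Counting h d k
  term : ℕ → ℕ → ℕ
  term i j = binom (+ n) (+ (2 * i + h)) * b (+ (2 * i + h)) (+ j) (+ i)
             * b (+ n - + (2 * i + h)) (+ k - + j) (+ d - + i - + h)
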